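{- The central tiered binomial coefficients $(n,n)_i$ satisfy for $n\ge 0$ \[ (n,n)_{2k+1}=-\sum_{j=0}^{k}e_{2k+1,2j}(n,n)_{2j}, \] where $E_m(x)=\sum_{j=0}^{m}e_{m,j}x^j$ is the $m$th Euler polynomial.
   Context: The tier-$i$ binomial coefficients are $(n,m)_i=\frac{1}{i+1}\sum_{k=0}^{n}(-1)^k\binom{n-k+m}{m}\zeta_{i}(\{1\}_{k})\zeta^{\star}_{i+1}(\{1\}_{n-k+m})$ for $i,n,m\ge0$, where $\zeta_n(\{1\}_k)=\sum_{n\ge\ell_1>\cdots>\ell_k\ge1}(\ell_1\cdots\ell_k)^{ -1}$ and $\zeta^{\star}_n(\{1\}_k)=\sum_{n\ge\ell_1\ge\cdots\ge\ell_k\ge1}(\ell_1\cdots\ell_k)^{ -1}$. The Euler polynomials have generating function $\sum_{m\ge0}E_m(x)t^m/m!=2e^{xt}/(e^t+1)$. -}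

module Defs where

open import Data.Nat as ℕ using (ℕ; zero; suc; _∸_)
open import Data.Nat.Combinatorics using (_C_)
open import Data.Integer using (+_)
open import Data.List using (List; []; _∷_; _++_; length)
open import Data.Rational using (ℚ; 0ℚ; 1ℚ; _+_; _*_; _-_; -_; _/_; ½)

sumTo : ℕ → (ℕ → ℚ) → ℚ
sumTo zero    f = f 0
sumTo (suc n) f = sumTo n f + f (suc n)

ℕ→ℚ : ℕ → ℚ
ℕ→ℚ n = + n / 1

-- 1 / ℓ for ℓ ≥ 1 (written with ℓ = suc l)
inv : ℕ → ℚ
inv l = + 1 / suc l

sgn : ℕ → ℚ
sgn zero    = 1ℚ
sgn (suc k) = - sgn k

-- ζ_n({1}_k) = Σ_{n ≥ ℓ₁ > ℓ₂ > ⋯ > ℓ_k ≥ 1} 1/(ℓ₁⋯ℓ_k)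
-- (sum over the largest index ℓ₁, the remaining indices lie in [1, ℓ₁ - 1])
ζ : ℕ → ℕ → ℚ
ζ n       zero    = 1ℚ
ζ zero    (suc k) = 0ℚ
ζ (suc n) (suc k) = ζ n (suc k) + inv n * ζ n k
-- the last line: terms with ℓ₁ ≤ n, plus terms with ℓ₁ = n+1 (rest in [1,n])

-- ζ*_n({1}_k) = Σ_{n ≥ ℓ₁ ≥ ℓ₂ ≥ ⋯ ≥ ℓ_k ≥ 1} 1/(ℓ₁⋯ℓ_k)
ζ⋆ : ℕ → ℕ → ℚ
ζ⋆ n       zero    = 1ℚ
ζ⋆ zero    (suc k) = 0ℚ
ζ⋆ (suc n) (suc k) = ζ⋆ n (suc k) + inv n * ζ⋆ (suc n) k
-- terms with ℓ₁ ≤ n, plus terms with ℓ₁ = n+1 (rest in [1,n+1])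

tier : ℕ → ℕ → ℕ → ℚ
tier i n m =
  (+ 1 / suc i) *
  sumTo n (λ k → sgn k * ℕ→ℚ ((n ∸ k ℕ.+ m) C m) * ζ i k * ζ⋆ (suc i) (n ∸ k ℕ.+ m))

-- Euler polynomials E_m(x) = Σ_j e_{m,j} x^j, defined by the generating
-- function Σ E_m(x) t^m/m! = 2 e^{xt}/(e^t+1). Comparing coefficients of
-- t^m in (e^t + 1) Σ E_m(x) t^m/m! = 2 e^{xt} gives
--   Σ_{k=0}^{m} C(m,k) E_k(x) + E_m(x) = 2 x^m,
-- i.e. E_m(x) = x^m - ½ Σ_{k<m} C(m,k) E_k(x), which determines them uniquely.
-- A row is the coefficient function j ↦ e_{m,j}.

δ : ℕ → ℕ → ℚ
δ zero    zero    = 1ℚ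
δ zero    (suc _) = 0ℚ
δ (suc _) zero    = 0ℚ
δ (suc a) (suc b) = δ a b

weighted : ℕ → ℕ → List (ℕ → ℚ) → ℕ → ℚ
weighted m start []       j = 0ℚ
weighted m start (r ∷ rs) j = ℕ→ℚ (m C start) * r j + weighted m (suc start) rs j

newRow : ℕ → List (ℕ → ℚ) → (ℕ → ℚ)
newRow m rows j = δ m j - ½ * weighted m 0 rows j

rowsBelow : ℕ → List (ℕ → ℚ)
rowsBelow zero    = []
rowsBelow (suc m) = rowsBelow m ++ (newRow m (rowsBelow m) ∷ [])

eulerCoeff : ℕ → ℕ → ℚ
eulerCoeff m j = newRow m (rowsBelow m) j

module Submission where

-- (1) Duality.  For all n, m, i:  Σ_{j ≤ i} C(i,j) (-1)ʲ (n,m)ⱼ = (m,n)ᵢ.  In the ring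
--     ℚ[[W]][[Z]] put 𝒜ᵣ(x) = Σₖ (-1)ᵏ ζᵣ({1}ₖ) xᵏ, ℬ_N = Σ_T ζ⋆_N({1}_T) (Z+W)ᵀ and
--     𝒬ᵢᵣ = r! i!/(r+i+1)! · 𝒜ᵣ(Z) 𝒜ᵢ(W) ℬ_{r+i+1}.  The recursions of ζ and ζ⋆ give
--     Pascal's rule 𝒬ᵢᵣ = 𝒬ᵢ,ᵣ₊₁ + 𝒬ᵢ₊₁,ᵣ, so [ZⁿWᵐ]𝒬 is a difference table; its top row
--     is ((n,m)_r)_r and its left column is ((m,n)_i)_i.
--
-- (2) Self-dual sequences.  Let 𝕋v(m) = Σ_{k ≤ m} C(m,k) vₖ + vₘ; the generating function
--     of the Euler polynomials says 𝕋 e_{·,j} = 2δ_{·,j}.  𝕋 is injective, and binomial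
--     inversion gives 𝕋 ∘ alternate = 𝔹 ∘ alternate ∘ 𝕋.  From this: e is unitriangular,
--     e_{m,j} = 0 for 0 < m - j even, and for f with Σ_j C(i,j)(-1)ʲ fⱼ = fᵢ the sequence
--     Σⱼ e_{m,j} fⱼ vanishes at odd m, which is the claimed identity for f.
--
-- By (1) with m = n, the sequence j ↦ (n,n)ⱼ is self-dual, and (2) applies.

open import Defs
open import Algebra using (CommutativeRing)

module RationalArithmetic where

  open import Data.Nat as ℕ using (ℕ; zero; suc)
  open import Data.Integer as ℤ using (+_)
  import Data.Integer.Properties as ℤP
  import Data.Integer.Solver as ℤSolver
  module ℤS = ℤSolver.+-*-Solver
  import Data.Nat.Properties as ℕP
  open import Data.Rational using (ℚ; 1ℚ; _+_; _*_; -_; ½; toℚᵘ)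
  open import Data.Rational.Properties
    using (toℚᵘ-injective; toℚᵘ-fromℚᵘ; toℚᵘ-homo-+; toℚᵘ-homo-*; *-identityˡ; neg-distribˡ-*; +-0-group)
  import Data.Rational.Unnormalised as ℚᵘ
  import Data.Rational.Unnormalised.Properties as ℚᵘP
  open import Data.Rational.Solver using (module +-*-Solver)
  open +-*-Solver
  open import Relation.Binary.PropositionalEquality
  open import Algebra.Properties.Group +-0-group public
    using () renaming (∙-cancelˡ to +-cancelˡ)

  ℕ→ℚ-unnormalised : ∀ n → toℚᵘ (ℕ→ℚ n) ℚᵘ.≃ ℚᵘ.mkℚᵘ (+ n) 0
  ℕ→ℚ-unnormalised n = toℚᵘ-fromℚᵘ (ℚᵘ.mkℚᵘ (+ n) 0)

  ℕ→ℚ-+ : ∀ a b → ℕ→ℚ (a ℕ.+ b) ≡ ℕ→ℚ a + ℕ→ℚ b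
  ℕ→ℚ-+ a b = toℚᵘ-injective (begin
    toℚᵘ (ℕ→ℚ (a ℕ.+ b))                 ≈⟨ ℕ→ℚ-unnormalised (a ℕ.+ b) ⟩
    ℚᵘ.mkℚᵘ (+ (a ℕ.+ b)) 0              ≈⟨ ℚᵘ.*≡* cross ⟩
    ℚᵘ.mkℚᵘ (+ a) 0 ℚᵘ.+ ℚᵘ.mkℚᵘ (+ b) 0 ≈⟨ ℚᵘP.+-cong (ℚᵘP.≃-sym (ℕ→ℚ-unnormalised a)) (ℚᵘP.≃-sym (ℕ→ℚ-unnormalised b)) ⟩
    toℚᵘ (ℕ→ℚ a) ℚᵘ.+ toℚᵘ (ℕ→ℚ b)       ≈⟨ ℚᵘP.≃-sym (toℚᵘ-homo-+ (ℕ→ℚ a) (ℕ→ℚ b)) ⟩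
    toℚᵘ (ℕ→ℚ a + ℕ→ℚ b)                 ∎)
    where
    open ℚᵘP.≃-Reasoning
    cross : + (a ℕ.+ b) ℤ.* + 1 ≡ (+ a ℤ.* + 1 ℤ.+ + b ℤ.* + 1) ℤ.* + 1
    cross = trans (cong (ℤ._* + 1) (ℤP.pos-+ a b))
      (ℤS.solve 2 (λ x y → (x ℤS.:+ y) ℤS.:* ℤS.con (+ 1)
                         ℤS.:= (x ℤS.:* ℤS.con (+ 1) ℤS.:+ y ℤS.:* ℤS.con (+ 1)) ℤS.:* ℤS.con (+ 1)) refl (+ a) (+ b))

  ℕ→ℚ-suc-*-inv : ∀ n → ℕ→ℚ (suc n) * inv n ≡ 1ℚ
  ℕ→ℚ-suc-*-inv n = toℚᵘ-injective (begin
    toℚᵘ (ℕ→ℚ (suc n) * inv n)                    ≈⟨ toℚᵘ-homo-* (ℕ→ℚ (suc n)) (inv n) ⟩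
    toℚᵘ (ℕ→ℚ (suc n)) ℚᵘ.* toℚᵘ (inv n)          ≈⟨ ℚᵘP.*-cong (ℕ→ℚ-unnormalised (suc n)) (toℚᵘ-fromℚᵘ (ℚᵘ.mkℚᵘ (+ 1) n)) ⟩
    ℚᵘ.mkℚᵘ (+ suc n) 0 ℚᵘ.* ℚᵘ.mkℚᵘ (+ 1) n       ≈⟨ ℚᵘ.*≡* cross ⟩
    toℚᵘ 1ℚ                                        ∎)
    where
    open ℚᵘP.≃-Reasoning
    cross : (+ suc n ℤ.* + 1) ℤ.* + 1 ≡ + 1 ℤ.* (+ 1 ℤ.* + suc n)
    cross = ℤS.solve 1 (λ x → (x ℤS.:* ℤS.con (+ 1)) ℤS.:* ℤS.con (+ 1)
                            ℤS.:= ℤS.con (+ 1) ℤS.:* (ℤS.con (+ 1) ℤS.:* x)) refl (+ suc n)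

  double-injective : ∀ x y → x + x ≡ y + y → x ≡ y
  double-injective x y 2x≡2y = begin
    x             ≡⟨ solve 1 (λ x → x := con ½ :* (x :+ x)) refl x ⟩
    ½ * (x + x)   ≡⟨ cong (½ *_) 2x≡2y ⟩
    ½ * (y + y)   ≡⟨ solve 1 (λ y → con ½ :* (y :+ y) := y) refl y ⟩
    y             ∎
    where open ≡-Reasoning

  sgn-+ : ∀ a b → sgn (a ℕ.+ b) ≡ sgn a * sgn b
  sgn-+ zero    b = sym (*-identityˡ (sgn b))
  sgn-+ (suc a) b = trans (cong -_ (sgn-+ a b)) (neg-distribˡ-* (sgn a) (sgn b))

  sgn-square : ∀ a → sgn a * sgn a ≡ 1ℚ
  sgn-square zero    = refl
  sgn-square (suc a) = trans (solve 1 (λ x → (:- x) :* (:- x) := x :* x) refl (sgn a)) (sgn-square a)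

  sgn-odd : ∀ k → sgn (2 ℕ.* k ℕ.+ 1) ≡ - 1ℚ
  sgn-odd k = begin
    sgn (2 ℕ.* k ℕ.+ 1)  ≡⟨ cong sgn (trans (ℕP.+-comm (2 ℕ.* k) 1) (cong (λ t → suc (k ℕ.+ t)) (ℕP.+-identityʳ k))) ⟩
    - sgn (k ℕ.+ k)      ≡⟨ cong -_ (trans (sgn-+ k k) (sgn-square k)) ⟩
    - 1ℚ                 ∎
    where open ≡-Reasoning

module FiniteSums where

  open import Data.Nat as ℕ using (ℕ; zero; suc; _≤_; _<_; z≤n; s≤s)
  import Data.Nat.Properties as ℕP
  open import Data.Rational using (ℚ; 0ℚ; 1ℚ; _+_; _*_; -_)
  import Data.Rational.Properties as ℚP
  open import Data.Rational.Solver using (module +-*-Solver)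
  open +-*-Solver
  open import Data.Sum using (inj₁; inj₂)
  open import Relation.Nullary using (¬_; contradiction)
  open import Relation.Binary.PropositionalEquality

  sumTo-cong≤ : ∀ n {f g : ℕ → ℚ} → (∀ k → k ≤ n → f k ≡ g k) → sumTo n f ≡ sumTo n g
  sumTo-cong≤ zero    f≡g = f≡g 0 z≤n
  sumTo-cong≤ (suc n) f≡g =
    cong₂ _+_ (sumTo-cong≤ n (λ k k≤n → f≡g k (ℕP.m≤n⇒m≤1+n k≤n))) (f≡g (suc n) ℕP.≤-refl)

  sumTo-cong : ∀ n {f g : ℕ → ℚ} → (∀ k → f k ≡ g k) → sumTo n f ≡ sumTo n g
  sumTo-cong n f≡g = sumTo-cong≤ n (λ k _ → f≡g k)

  sumTo-+ : ∀ n (f g : ℕ → ℚ) → sumTo n (λ k → f k + g k) ≡ sumTo n f + sumTo n g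
  sumTo-+ zero    f g = refl
  sumTo-+ (suc n) f g = trans (cong (_+ (f (suc n) + g (suc n))) (sumTo-+ n f g))
    (solve 4 (λ a b c d → (a :+ b) :+ (c :+ d) := (a :+ c) :+ (b :+ d)) refl
       (sumTo n f) (sumTo n g) (f (suc n)) (g (suc n)))

  sumTo-scale : ∀ n c (f : ℕ → ℚ) → sumTo n (λ k → c * f k) ≡ c * sumTo n f
  sumTo-scale zero    c f = refl
  sumTo-scale (suc n) c f = trans (cong (_+ (c * f (suc n))) (sumTo-scale n c f))
    (sym (ℚP.*-distribˡ-+ c (sumTo n f) (f (suc n))))

  sumTo-neg : ∀ n (f : ℕ → ℚ) → sumTo n (λ k → - f k) ≡ - sumTo n f
  sumTo-neg zero    f = refl
  sumTo-neg (suc n) f = trans (cong (_+ (- f (suc n))) (sumTo-neg n f))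
    (sym (ℚP.neg-distrib-+ (sumTo n f) (f (suc n))))

  sumTo-suc-head : ∀ n (f : ℕ → ℚ) → sumTo (suc n) f ≡ f 0 + sumTo n (λ k → f (suc k))
  sumTo-suc-head zero    f = refl
  sumTo-suc-head (suc n) f = trans (cong (_+ f (suc (suc n))) (sumTo-suc-head n f))
    (ℚP.+-assoc (f 0) (sumTo n (λ k → f (suc k))) (f (suc (suc n))))

  sumTo-zero : ∀ n (f : ℕ → ℚ) → (∀ k → k ≤ n → f k ≡ 0ℚ) → sumTo n f ≡ 0ℚ
  sumTo-zero zero    f f≡0 = f≡0 0 z≤n
  sumTo-zero (suc n) f f≡0 =
    cong₂ _+_ (sumTo-zero n f (λ k k≤n → f≡0 k (ℕP.m≤n⇒m≤1+n k≤n))) (f≡0 (suc n) ℕP.≤-refl)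

  sumTo-swap : ∀ n (F : ℕ → ℕ → ℚ) →
    sumTo n (λ t → sumTo n (F t)) ≡ sumTo n (λ j → sumTo n (λ t → F t j))
  sumTo-swap zero    F = refl
  sumTo-swap (suc n) F = begin
    sumTo n (λ t → sumTo n (F t) + F t (suc n)) + (row + corner)
      ≡⟨ cong (_+ (row + corner)) (sumTo-+ n (λ t → sumTo n (F t)) (λ t → F t (suc n))) ⟩
    (sumTo n (λ t → sumTo n (F t)) + column) + (row + corner)
      ≡⟨ cong (λ x → (x + column) + (row + corner)) (sumTo-swap n F) ⟩
    (sumTo n (λ j → sumTo n (λ t → F t j)) + column) + (row + corner)
      ≡⟨ solve 4 (λ a b c d → (a :+ b) :+ (c :+ d) := (a :+ c) :+ (b :+ d)) refl
           (sumTo n (λ j → sumTo n (λ t → F t j))) column row corner ⟩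
    (sumTo n (λ j → sumTo n (λ t → F t j)) + row) + (column + corner)
      ≡⟨ cong (_+ (column + corner)) (sym (sumTo-+ n (λ j → sumTo n (λ t → F t j)) (F (suc n)))) ⟩
    sumTo n (λ j → sumTo n (λ t → F t j) + F (suc n) j) + (column + corner) ∎
    where
    open ≡-Reasoning
    row    = sumTo n (F (suc n))
    column = sumTo n (λ t → F t (suc n))
    corner = F (suc n) (suc n)

  sumTo-truncate : ∀ k m (F : ℕ → ℚ) → k ≤ m → (∀ j → k < j → j ≤ m → F j ≡ 0ℚ) →
    sumTo k F ≡ sumTo m F
  sumTo-truncate k zero    F z≤n _ = refl
  sumTo-truncate k (suc m) F k≤1+m F≡0 with ℕP.m≤n⇒m<n∨m≡n k≤1+m
  ... | inj₂ refl = refl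
  ... | inj₁ k<1+m = begin
    sumTo k F              ≡⟨ sumTo-truncate k m F (ℕP.≤-pred k<1+m) (λ j k<j j≤m → F≡0 j k<j (ℕP.m≤n⇒m≤1+n j≤m)) ⟩
    sumTo m F              ≡⟨ sym (ℚP.+-identityʳ (sumTo m F)) ⟩
    sumTo m F + 0ℚ         ≡⟨ cong (sumTo m F +_) (sym (F≡0 (suc m) k<1+m ℕP.≤-refl)) ⟩
    sumTo m F + F (suc m)  ∎
    where open ≡-Reasoning

  sumTo-last : ∀ k (F : ℕ → ℚ) → (∀ j → j < k → F j ≡ 0ℚ) → sumTo k F ≡ F k
  sumTo-last zero    F _   = refl
  sumTo-last (suc k) F F≡0 = trans (cong (_+ F (suc k)) (sumTo-zero k F (λ j j≤k → F≡0 j (s≤s j≤k))))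
    (ℚP.+-identityˡ (F (suc k)))

  sumTo-pairs : ∀ k (F : ℕ → ℚ) →
    sumTo (2 ℕ.* k ℕ.+ 1) F ≡ sumTo k (λ j → F (2 ℕ.* j) + F (2 ℕ.* j ℕ.+ 1))
  sumTo-pairs zero    F = refl
  sumTo-pairs (suc k) F = begin
    sumTo (2 ℕ.* suc k ℕ.+ 1) F
      ≡⟨ cong (λ n → sumTo n F) (cong (ℕ._+ 1) (ℕP.*-suc 2 k)) ⟩
    sumTo (2 ℕ.* k ℕ.+ 1) F + F even + F odd
      ≡⟨ cong (λ x → x + F even + F odd) (sumTo-pairs k F) ⟩
    S + F even + F odd
      ≡⟨ ℚP.+-assoc S (F even) (F odd) ⟩
    S + (F even + F odd)
      ≡⟨ cong₂ (λ a b → S + (F a + F b)) (sym even≡) (cong (ℕ._+ 1) (sym (ℕP.*-suc 2 k))) ⟩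
    S + (F (2 ℕ.* suc k) + F (2 ℕ.* suc k ℕ.+ 1)) ∎
    where
    open ≡-Reasoning
    S    = sumTo k (λ j → F (2 ℕ.* j) + F (2 ℕ.* j ℕ.+ 1))
    even = suc (2 ℕ.* k ℕ.+ 1)
    odd  = suc (suc (2 ℕ.* k ℕ.+ 1))
    even≡ : 2 ℕ.* suc k ≡ even
    even≡ = trans (ℕP.*-suc 2 k) (cong suc (ℕP.+-comm 1 (2 ℕ.* k)))

  δ-diagonal : ∀ j → δ j j ≡ 1ℚ
  δ-diagonal zero    = refl
  δ-diagonal (suc j) = δ-diagonal j

  δ-off-diagonal : ∀ t j → ¬ t ≡ j → δ t j ≡ 0ℚ
  δ-off-diagonal zero    zero    t≢j = contradiction refl t≢j
  δ-off-diagonal zero    (suc j) _   = refl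
  δ-off-diagonal (suc t) zero    _   = refl
  δ-off-diagonal (suc t) (suc j) t≢j = δ-off-diagonal t j (λ t≡j → t≢j (cong suc t≡j))

  δ-sym : ∀ a b → δ a b ≡ δ b a
  δ-sym zero    zero    = refl
  δ-sym zero    (suc b) = refl
  δ-sym (suc a) zero    = refl
  δ-sym (suc a) (suc b) = δ-sym a b

  <⇒δ≡0 : ∀ t j → t < j → δ t j ≡ 0ℚ
  <⇒δ≡0 t j t<j = δ-off-diagonal t j (λ { refl → ℕP.<-irrefl refl t<j })

  >⇒δ≡0 : ∀ t j → j < t → δ t j ≡ 0ℚ
  >⇒δ≡0 t j j<t = δ-off-diagonal t j (λ { refl → ℕP.<-irrefl refl j<t })

  sumTo-δ-outside : ∀ m j (F : ℕ → ℚ) → m < j → sumTo m (λ t → F t * δ t j) ≡ 0ℚ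
  sumTo-δ-outside m j F m<j = sumTo-zero m (λ t → F t * δ t j)
    (λ t t≤m → trans (cong (F t *_) (<⇒δ≡0 t j (ℕP.≤-<-trans t≤m m<j))) (ℚP.*-zeroʳ (F t)))

  sumTo-δ : ∀ m j (F : ℕ → ℚ) → j ≤ m → sumTo m (λ t → F t * δ t j) ≡ F j
  sumTo-δ m j F j≤m = begin
    sumTo m (λ t → F t * δ t j) ≡⟨ sym (sumTo-truncate j m _ j≤m (λ t j<t _ → trans (cong (F t *_) (>⇒δ≡0 t j j<t)) (ℚP.*-zeroʳ (F t)))) ⟩
    sumTo j (λ t → F t * δ t j) ≡⟨ sumTo-last j _ (λ t t<j → trans (cong (F t *_) (<⇒δ≡0 t j t<j)) (ℚP.*-zeroʳ (F t))) ⟩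
    F j * δ j j                 ≡⟨ trans (cong (F j *_) (δ-diagonal j)) (ℚP.*-identityʳ (F j)) ⟩
    F j                         ∎
    where open ≡-Reasoning

  sumBelow : ℕ → (ℕ → ℚ) → ℚ
  sumBelow zero    f = 0ℚ
  sumBelow (suc n) f = sumBelow n f + f n

  sumTo-sumBelow : ∀ n (f : ℕ → ℚ) → sumTo n f ≡ sumBelow n f + f n
  sumTo-sumBelow zero    f = sym (ℚP.+-identityˡ (f 0))
  sumTo-sumBelow (suc n) f = cong (_+ f (suc n)) (sumTo-sumBelow n f)

  sumBelow-cong< : ∀ n {f g : ℕ → ℚ} → (∀ k → k < n → f k ≡ g k) → sumBelow n f ≡ sumBelow n g
  sumBelow-cong< zero    f≡g = refl
  sumBelow-cong< (suc n) f≡g = cong₂ _+_ (sumBelow-cong< n (λ k k<n → f≡g k (ℕP.m<n⇒m<1+n k<n))) (f≡g n ℕP.≤-refl)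

module BinomialTransform where

  open RationalArithmetic
  open FiniteSums
  open import Data.Nat as ℕ using (ℕ; zero; suc; _≤_; _<_; z≤n)
  import Data.Nat.Properties as ℕP
  open import Data.Nat.Combinatorics using (_C_; nCn≡1; k>n⇒nCk≡0; nCk+nC[k+1]≡[n+1]C[k+1])
  open import Data.Rational using (ℚ; 0ℚ; 1ℚ; _+_; _*_; -_; _-_)
  import Data.Rational.Properties as ℚP
  open import Data.Rational.Solver using (module +-*-Solver)
  open +-*-Solver
  open import Data.Sum using (inj₁; inj₂)
  open import Relation.Binary.PropositionalEquality

  binomial : (ℕ → ℚ) → ℕ → ℚ
  binomial a m = sumTo m (λ t → ℕ→ℚ (m C t) * a t)

  alternate : (ℕ → ℚ) → ℕ → ℚ
  alternate a t = sgn t * a t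

  shift : (ℕ → ℚ) → ℕ → ℚ
  shift a t = a (suc t)

  binomial-cong : ∀ m {a b : ℕ → ℚ} → (∀ t → a t ≡ b t) → binomial a m ≡ binomial b m
  binomial-cong m a≡b = sumTo-cong m (λ t → cong (ℕ→ℚ (m C t) *_) (a≡b t))

  binomial-+ : ∀ m (a b : ℕ → ℚ) → binomial (λ t → a t + b t) m ≡ binomial a m + binomial b m
  binomial-+ m a b = trans (sumTo-cong m (λ t → ℚP.*-distribˡ-+ (ℕ→ℚ (m C t)) (a t) (b t)))
    (sumTo-+ m (λ t → ℕ→ℚ (m C t) * a t) (λ t → ℕ→ℚ (m C t) * b t))

  binomial-scale : ∀ m c (a : ℕ → ℚ) → binomial (λ t → c * a t) m ≡ c * binomial a m
  binomial-scale m c a = trans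
    (sumTo-cong m (λ t → solve 3 (λ x c y → x :* (c :* y) := c :* (x :* y)) refl (ℕ→ℚ (m C t)) c (a t)))
    (sumTo-scale m c (λ t → ℕ→ℚ (m C t) * a t))

  binomial-neg : ∀ m (a : ℕ → ℚ) → binomial (λ t → - a t) m ≡ - binomial a m
  binomial-neg m a = trans (sumTo-cong m (λ t → sym (ℚP.neg-distribʳ-* (ℕ→ℚ (m C t)) (a t))))
    (sumTo-neg m (λ t → ℕ→ℚ (m C t) * a t))

  binomial-δ : ∀ m j → binomial (λ t → δ t j) m ≡ ℕ→ℚ (m C j)
  binomial-δ m j with ℕP.≤-<-connex j m
  ... | inj₁ j≤m = sumTo-δ m j (λ t → ℕ→ℚ (m C t)) j≤m
  ... | inj₂ m<j = trans (sumTo-δ-outside m j (λ t → ℕ→ℚ (m C t)) m<j) (cong ℕ→ℚ (sym (k>n⇒nCk≡0 m<j)))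

  -- 𝔹a m with its first term split off; the top term C(m,m+1) a_{m+1} is zero.
  binomial-head : ∀ m (a : ℕ → ℚ) → a 0 + sumTo m (λ t → ℕ→ℚ (m C suc t) * a (suc t)) ≡ binomial a m
  binomial-head zero    a = solve 2 (λ x y → x :+ con 0ℚ :* y := con 1ℚ :* x) refl (a 0) (a 1)
  binomial-head (suc m) a = begin
    a 0 + (sumTo m (λ t → ℕ→ℚ (suc m C suc t) * a (suc t)) + ℕ→ℚ (suc m C suc (suc m)) * a (suc (suc m)))
      ≡⟨ cong (λ c → a 0 + (sumTo m (λ t → ℕ→ℚ (suc m C suc t) * a (suc t)) + ℕ→ℚ c * a (suc (suc m))))
              (k>n⇒nCk≡0 (ℕP.n<1+n (suc m))) ⟩
    a 0 + (sumTo m (λ t → ℕ→ℚ (suc m C suc t) * a (suc t)) + 0ℚ * a (suc (suc m)))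
      ≡⟨ solve 3 (λ x y z → x :+ (y :+ con 0ℚ :* z) := con 1ℚ :* x :+ y) refl
           (a 0) (sumTo m (λ t → ℕ→ℚ (suc m C suc t) * a (suc t))) (a (suc (suc m))) ⟩
    1ℚ * a 0 + sumTo m (λ t → ℕ→ℚ (suc m C suc t) * a (suc t))
      ≡⟨ sym (sumTo-suc-head m (λ t → ℕ→ℚ (suc m C t) * a t)) ⟩
    binomial a (suc m) ∎
    where open ≡-Reasoning

  binomial-suc : ∀ m (a : ℕ → ℚ) → binomial a (suc m) ≡ binomial a m + binomial (shift a) m
  binomial-suc m a = begin
    binomial a (suc m)
      ≡⟨ sumTo-suc-head m (λ t → ℕ→ℚ (suc m C t) * a t) ⟩
    1ℚ * a 0 + sumTo m (λ t → ℕ→ℚ (suc m C suc t) * a (suc t))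
      ≡⟨ cong (1ℚ * a 0 +_) (sumTo-cong m pascal) ⟩
    1ℚ * a 0 + sumTo m (λ t → ℕ→ℚ (m C t) * a (suc t) + ℕ→ℚ (m C suc t) * a (suc t))
      ≡⟨ cong (1ℚ * a 0 +_) (sumTo-+ m (λ t → ℕ→ℚ (m C t) * a (suc t)) upper) ⟩
    1ℚ * a 0 + (binomial (shift a) m + sumTo m upper)
      ≡⟨ solve 3 (λ x y z → con 1ℚ :* x :+ (y :+ z) := (x :+ z) :+ y) refl (a 0) (binomial (shift a) m) (sumTo m upper) ⟩
    (a 0 + sumTo m upper) + binomial (shift a) m
      ≡⟨ cong (_+ binomial (shift a) m) (binomial-head m a) ⟩
    binomial a m + binomial (shift a) m ∎
    where
    open ≡-Reasoning
    upper : ℕ → ℚ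
    upper t = ℕ→ℚ (m C suc t) * a (suc t)

    pascal : ∀ t → ℕ→ℚ (suc m C suc t) * a (suc t) ≡ ℕ→ℚ (m C t) * a (suc t) + ℕ→ℚ (m C suc t) * a (suc t)
    pascal t = begin
      ℕ→ℚ (suc m C suc t) * a (suc t)
        ≡⟨ cong (λ c → ℕ→ℚ c * a (suc t)) (sym (nCk+nC[k+1]≡[n+1]C[k+1] m t)) ⟩
      ℕ→ℚ (m C t ℕ.+ m C suc t) * a (suc t)
        ≡⟨ cong (_* a (suc t)) (ℕ→ℚ-+ (m C t) (m C suc t)) ⟩
      (ℕ→ℚ (m C t) + ℕ→ℚ (m C suc t)) * a (suc t)
        ≡⟨ ℚP.*-distribʳ-+ (a (suc t)) (ℕ→ℚ (m C t)) (ℕ→ℚ (m C suc t)) ⟩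
      ℕ→ℚ (m C t) * a (suc t) + ℕ→ℚ (m C suc t) * a (suc t) ∎


  binomial-inversion : ∀ r (a : ℕ → ℚ) → binomial (alternate (binomial a)) r ≡ sgn r * a r
  binomial-inversion zero    a = solve 1 (λ x → con 1ℚ :* (con 1ℚ :* (con 1ℚ :* x)) := con 1ℚ :* x) refl (a 0)
  binomial-inversion (suc r) a = begin
    binomial (alternate (binomial a)) (suc r)
      ≡⟨ binomial-suc r (alternate (binomial a)) ⟩
    B a + binomial (λ t → - sgn t * binomial a (suc t)) r
      ≡⟨ cong (B a +_) (binomial-cong r split) ⟩
    B a + binomial (λ t → - alternate (binomial a) t + - alternate (binomial (shift a)) t) r
      ≡⟨ cong (B a +_) (trans (binomial-+ r (λ t → - alternate (binomial a) t) (λ t → - alternate (binomial (shift a)) t))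
                              (cong₂ _+_ (binomial-neg r (alternate (binomial a))) (binomial-neg r (alternate (binomial (shift a)))))) ⟩
    B a + (- B a + - B (shift a))
      ≡⟨ cong (λ x → B a + (- B a + - x)) (binomial-inversion r (shift a)) ⟩
    B a + (- B a + - (sgn r * a (suc r)))
      ≡⟨ solve 3 (λ x s y → x :+ ((:- x) :+ (:- (s :* y))) := (:- s) :* y) refl (B a) (sgn r) (a (suc r)) ⟩
    sgn (suc r) * a (suc r) ∎
    where
    open ≡-Reasoning
    B : (ℕ → ℚ) → ℚ
    B a = binomial (alternate (binomial a)) r
    split : ∀ t → - sgn t * binomial a (suc t) ≡ - alternate (binomial a) t + - alternate (binomial (shift a)) t
    split t = trans (cong (λ x → - sgn t * x) (binomial-suc t a))
      (solve 3 (λ s x y → (:- s) :* (x :+ y) := (:- (s :* x)) :+ (:- (s :* y))) refl (sgn t) (binomial a t) (binomial (shift a) t))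

  difference-table : ∀ (q : ℕ → ℕ → ℚ) (a : ℕ → ℚ) →
    (∀ r → q 0 r ≡ a r) → (∀ i r → q (suc i) r ≡ q i r - q i (suc r)) →
    ∀ i r → binomial (λ j → sgn j * a (j ℕ.+ r)) i ≡ q i r
  difference-table q a top step zero    r = trans (solve 1 (λ x → con 1ℚ :* (con 1ℚ :* x) := x) refl (a r)) (sym (top r))
  difference-table q a top step (suc i) r = begin
    binomial (λ j → sgn j * a (j ℕ.+ r)) (suc i)
      ≡⟨ binomial-suc i (λ j → sgn j * a (j ℕ.+ r)) ⟩
    binomial (λ j → sgn j * a (j ℕ.+ r)) i + binomial (λ j → - sgn j * a (suc j ℕ.+ r)) i
      ≡⟨ cong (binomial (λ j → sgn j * a (j ℕ.+ r)) i +_)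
              (trans (binomial-cong i moved) (binomial-neg i (λ j → sgn j * a (j ℕ.+ suc r)))) ⟩
    binomial (λ j → sgn j * a (j ℕ.+ r)) i - binomial (λ j → sgn j * a (j ℕ.+ suc r)) i
      ≡⟨ cong₂ _-_ (difference-table q a top step i r) (difference-table q a top step i (suc r)) ⟩
    q i r - q i (suc r)
      ≡⟨ sym (step i r) ⟩
    q (suc i) r ∎
    where
    open ≡-Reasoning
    moved : ∀ j → - sgn j * a (suc j ℕ.+ r) ≡ - (sgn j * a (j ℕ.+ suc r))
    moved j = trans (cong (λ n → - sgn j * a n) (sym (ℕP.+-suc j r))) (sym (ℚP.neg-distribˡ-* (sgn j) (a (j ℕ.+ suc r))))

  -- The operator of the Euler recursion: (𝕋 v)ₘ = Σ_{k ≤ m} C(m,k) vₖ + vₘ.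
  -- Comparing coefficients in (eᵗ + 1)·Σ Eₘ(x) tᵐ/m! = 2eˣᵗ says exactly 𝕋 E = 2xᵐ.
  eulerOp : (ℕ → ℚ) → ℕ → ℚ
  eulerOp v m = binomial v m + v m

  eulerOp-+ : ∀ m (a b : ℕ → ℚ) → eulerOp (λ t → a t + b t) m ≡ eulerOp a m + eulerOp b m
  eulerOp-+ m a b = trans (cong (_+ (a m + b m)) (binomial-+ m a b))
    (solve 4 (λ x y z w → (x :+ y) :+ (z :+ w) := (x :+ z) :+ (y :+ w)) refl (binomial a m) (binomial b m) (a m) (b m))

  eulerOp-scale : ∀ m c (a : ℕ → ℚ) → eulerOp (λ t → c * a t) m ≡ c * eulerOp a m
  eulerOp-scale m c a = trans (cong (_+ c * a m) (binomial-scale m c a)) (sym (ℚP.*-distribˡ-+ c (binomial a m) (a m)))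

  eulerOp-top : ∀ m (v : ℕ → ℚ) → eulerOp v m ≡ sumBelow m (λ t → ℕ→ℚ (m C t) * v t) + (v m + v m)
  eulerOp-top m v = begin
    binomial v m + v m                              ≡⟨ cong (_+ v m) (sumTo-sumBelow m (λ t → ℕ→ℚ (m C t) * v t)) ⟩
    (L + ℕ→ℚ (m C m) * v m) + v m                   ≡⟨ cong (λ c → (L + ℕ→ℚ c * v m) + v m) (nCn≡1 m) ⟩
    (L + 1ℚ * v m) + v m                            ≡⟨ solve 2 (λ L x → (L :+ con 1ℚ :* x) :+ x := L :+ (x :+ x)) refl L (v m) ⟩
    L + (v m + v m)                                 ∎
    where
    open ≡-Reasoning
    L = sumBelow m (λ t → ℕ→ℚ (m C t) * v t)

  eulerOp-top-determined : ∀ m (v w : ℕ → ℚ) → (∀ t → t < m → v t ≡ w t) →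
    eulerOp v m ≡ eulerOp w m → v m ≡ w m
  eulerOp-top-determined m v w below 𝕋v≡𝕋w = double-injective (v m) (w m) (+-cancelˡ L (v m + v m) (w m + w m) (begin
    L + (v m + v m)                                ≡⟨ sym (eulerOp-top m v) ⟩
    eulerOp v m                                    ≡⟨ 𝕋v≡𝕋w ⟩
    eulerOp w m                                    ≡⟨ eulerOp-top m w ⟩
    sumBelow m (λ t → ℕ→ℚ (m C t) * w t) + (w m + w m) ≡⟨ cong (_+ (w m + w m)) (sym lower) ⟩
    L + (w m + w m)                                ∎))
    where
    open ≡-Reasoning
    L = sumBelow m (λ t → ℕ→ℚ (m C t) * v t)
    lower : L ≡ sumBelow m (λ t → ℕ→ℚ (m C t) * w t)
    lower = sumBelow-cong< m (λ t t<m → cong (ℕ→ℚ (m C t) *_) (below t t<m))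

  eulerOp-injective≤ : ∀ M (v w : ℕ → ℚ) → (∀ m → m ≤ M → eulerOp v m ≡ eulerOp w m) →
    ∀ m → m ≤ M → v m ≡ w m
  eulerOp-injective≤ zero    v w 𝕋v≡𝕋w .zero z≤n = eulerOp-top-determined 0 v w (λ _ ()) (𝕋v≡𝕋w 0 z≤n)
  eulerOp-injective≤ (suc M) v w 𝕋v≡𝕋w = extend
    where
    agree : ∀ m → m ≤ M → v m ≡ w m
    agree = eulerOp-injective≤ M v w (λ k k≤M → 𝕋v≡𝕋w k (ℕP.m≤n⇒m≤1+n k≤M))
    extend : ∀ m → m ≤ suc M → v m ≡ w m
    extend m m≤1+M with ℕP.m≤n⇒m<n∨m≡n m≤1+M
    ... | inj₁ m<1+M = agree m (ℕP.≤-pred m<1+M)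
    ... | inj₂ refl  = eulerOp-top-determined (suc M) v w (λ t t<1+M → agree t (ℕP.≤-pred t<1+M))
                         (𝕋v≡𝕋w (suc M) ℕP.≤-refl)

  eulerOp-injective : ∀ (v w : ℕ → ℚ) → (∀ m → eulerOp v m ≡ eulerOp w m) → ∀ m → v m ≡ w m
  eulerOp-injective v w 𝕋v≡𝕋w m = eulerOp-injective≤ m v w (λ k _ → 𝕋v≡𝕋w k) m ℕP.≤-refl

  eulerOp-alternate : ∀ m (v : ℕ → ℚ) → eulerOp (alternate v) m ≡ binomial (alternate (eulerOp v)) m
  eulerOp-alternate m v = begin
    binomial (alternate v) m + sgn m * v m
      ≡⟨ cong (binomial (alternate v) m +_) (sym (binomial-inversion m v)) ⟩
    binomial (alternate v) m + binomial (alternate (binomial v)) m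
      ≡⟨ sym (binomial-+ m (alternate v) (alternate (binomial v))) ⟩
    binomial (λ t → sgn t * v t + sgn t * binomial v t) m
      ≡⟨ binomial-cong m (λ t → trans (sym (ℚP.*-distribˡ-+ (sgn t) (v t) (binomial v t))) (cong (sgn t *_) (ℚP.+-comm (v t) (binomial v t)))) ⟩
    binomial (alternate (eulerOp v)) m ∎
    where open ≡-Reasoning

module EulerCoefficients where

  open RationalArithmetic
  open FiniteSums
  open BinomialTransform
  open import Data.Nat as ℕ using (ℕ; zero; suc; _≤_; _<_)
  import Data.Nat.Properties as ℕP
  open import Data.Nat.Combinatorics using (_C_; nCn≡1; k>n⇒nCk≡0)
  open import Data.Rational using (ℚ; 0ℚ; 1ℚ; _+_; _*_; -_; _-_; ½)
  import Data.Rational.Properties as ℚP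
  open import Data.Rational.Solver using (module +-*-Solver)
  open +-*-Solver
  open import Data.List using (List; []; _∷_; _++_; length)
  import Data.List.Properties as ListP
  open import Data.Sum using (inj₁; inj₂)
  open import Relation.Binary.PropositionalEquality

  weighted-snoc : ∀ m s (rows : List (ℕ → ℚ)) row j →
    weighted m s (rows ++ row ∷ []) j ≡ weighted m s rows j + ℕ→ℚ (m C (s ℕ.+ length rows)) * row j
  weighted-snoc m s []           row j = trans (ℚP.+-identityʳ _)
    (trans (cong (λ k → ℕ→ℚ (m C k) * row j) (sym (ℕP.+-identityʳ s))) (sym (ℚP.+-identityˡ _)))
  weighted-snoc m s (r ∷ rows) row j = begin
    ℕ→ℚ (m C s) * r j + weighted m (suc s) (rows ++ row ∷ []) j
      ≡⟨ cong (ℕ→ℚ (m C s) * r j +_) (weighted-snoc m (suc s) rows row j) ⟩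
    ℕ→ℚ (m C s) * r j + (weighted m (suc s) rows j + ℕ→ℚ (m C (suc s ℕ.+ length rows)) * row j)
      ≡⟨ sym (ℚP.+-assoc (ℕ→ℚ (m C s) * r j) (weighted m (suc s) rows j) _) ⟩
    ℕ→ℚ (m C s) * r j + weighted m (suc s) rows j + ℕ→ℚ (m C (suc s ℕ.+ length rows)) * row j
      ≡⟨ cong (λ k → ℕ→ℚ (m C s) * r j + weighted m (suc s) rows j + ℕ→ℚ (m C k) * row j) (sym (ℕP.+-suc s (length rows))) ⟩
    ℕ→ℚ (m C s) * r j + weighted m (suc s) rows j + ℕ→ℚ (m C (s ℕ.+ suc (length rows))) * row j ∎
    where open ≡-Reasoning

  length-rowsBelow : ∀ r → length (rowsBelow r) ≡ r
  length-rowsBelow zero    = refl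
  length-rowsBelow (suc r) = trans (ListP.length-++ (rowsBelow r))
    (trans (ℕP.+-comm (length (rowsBelow r)) 1) (cong suc (length-rowsBelow r)))

  weighted-rowsBelow : ∀ m r j → weighted m 0 (rowsBelow r) j ≡ sumBelow r (λ k → ℕ→ℚ (m C k) * eulerCoeff k j)
  weighted-rowsBelow m zero    j = refl
  weighted-rowsBelow m (suc r) j = trans (weighted-snoc m 0 (rowsBelow r) (eulerCoeff r) j)
    (cong₂ _+_ (weighted-rowsBelow m r j) (cong (λ k → ℕ→ℚ (m C k) * eulerCoeff r j) (length-rowsBelow r)))

  eulerCoeff-recursion : ∀ m j → eulerOp (λ k → eulerCoeff k j) m ≡ δ m j + δ m j
  eulerCoeff-recursion m j = begin
    eulerOp (λ k → eulerCoeff k j) m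
      ≡⟨ eulerOp-top m (λ k → eulerCoeff k j) ⟩
    B + (eulerCoeff m j + eulerCoeff m j)
      ≡⟨ cong (λ e → B + (e + e)) (cong (λ w → δ m j - ½ * w) (weighted-rowsBelow m m j)) ⟩
    B + ((δ m j - ½ * B) + (δ m j - ½ * B))
      ≡⟨ solve 2 (λ B d → B :+ ((d :- con ½ :* B) :+ (d :- con ½ :* B)) := d :+ d) refl B (δ m j) ⟩
    δ m j + δ m j ∎
    where
    open ≡-Reasoning
    B = sumBelow m (λ k → ℕ→ℚ (m C k) * eulerCoeff k j)

  -- The Euler coefficient matrix is unitriangular: e_{m,j} = δ_{m,j} for m ≤ j.
  -- (The column δ_{·,j} satisfies the same recursion for m ≤ j, as C(m,j) = δ_{m,j} there.)
  eulerCoeff-triangular : ∀ j m → m ≤ j → eulerCoeff m j ≡ δ m j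
  eulerCoeff-triangular j = eulerOp-injective≤ j (λ k → eulerCoeff k j) (λ t → δ t j) same
    where
    same : ∀ m → m ≤ j → eulerOp (λ k → eulerCoeff k j) m ≡ eulerOp (λ t → δ t j) m
    same m m≤j with ℕP.m≤n⇒m<n∨m≡n m≤j
    ... | inj₁ m<j = begin
      eulerOp (λ k → eulerCoeff k j) m ≡⟨ eulerCoeff-recursion m j ⟩
      δ m j + δ m j                    ≡⟨ cong₂ _+_ (trans (<⇒δ≡0 m j m<j) (cong ℕ→ℚ (sym (k>n⇒nCk≡0 m<j)))) refl ⟩
      ℕ→ℚ (m C j) + δ m j              ≡⟨ cong (_+ δ m j) (sym (binomial-δ m j)) ⟩
      eulerOp (λ t → δ t j) m          ∎
      where open ≡-Reasoning
    ... | inj₂ refl = begin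
      eulerOp (λ k → eulerCoeff k m) m ≡⟨ eulerCoeff-recursion m m ⟩
      δ m m + δ m m                    ≡⟨ cong₂ _+_ (trans (δ-diagonal m) (cong ℕ→ℚ (sym (nCn≡1 m)))) refl ⟩
      ℕ→ℚ (m C m) + δ m m              ≡⟨ cong (_+ δ m m) (sym (binomial-δ m m)) ⟩
      eulerOp (λ t → δ t m) m          ∎
      where open ≡-Reasoning

  eulerCoeff-diagonal : ∀ m → eulerCoeff m m ≡ 1ℚ
  eulerCoeff-diagonal m = trans (eulerCoeff-triangular m m ℕP.≤-refl) (δ-diagonal m)

  sgn-δ : ∀ t j → sgn t * δ t j ≡ sgn j * δ t j
  sgn-δ zero    zero    = refl
  sgn-δ zero    (suc j) = trans (ℚP.*-zeroʳ 1ℚ) (sym (ℚP.*-zeroʳ (sgn (suc j))))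
  sgn-δ (suc t) zero    = trans (ℚP.*-zeroʳ (sgn (suc t))) (sym (ℚP.*-zeroʳ 1ℚ))
  sgn-δ (suc t) (suc j) = begin
    - sgn t * δ t j    ≡⟨ sym (ℚP.neg-distribˡ-* (sgn t) (δ t j)) ⟩
    - (sgn t * δ t j)  ≡⟨ cong -_ (sgn-δ t j) ⟩
    - (sgn j * δ t j)  ≡⟨ ℚP.neg-distribˡ-* (sgn j) (δ t j) ⟩
    - sgn j * δ t j    ∎
    where open ≡-Reasoning

  -- A sign symmetry of the Euler coefficients, e_{m,j} = 2δ_{m,j} - (-1)^{j+m} e_{m,j}:
  -- both sides have the same image 2δ_{·,j} under 𝕋, by binomial inversion.
  eulerCoeff-reflection : ∀ j m → eulerCoeff m j ≡ (δ m j + δ m j) + (- sgn j) * (sgn m * eulerCoeff m j)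
  eulerCoeff-reflection j = eulerOp-injective g h (λ m → trans (eulerCoeff-recursion m j) (sym (𝕋h m)))
    where
    s = sgn j
    g h : ℕ → ℚ
    g k = eulerCoeff k j
    h k = (δ k j + δ k j) + (- s) * alternate g k

    𝕋-alternate-g : ∀ m → eulerOp (alternate g) m ≡ s * (ℕ→ℚ (m C j) + ℕ→ℚ (m C j))
    𝕋-alternate-g m = begin
      eulerOp (alternate g) m
        ≡⟨ eulerOp-alternate m g ⟩
      binomial (λ t → sgn t * eulerOp g t) m
        ≡⟨ binomial-cong m (λ t → cong (sgn t *_) (eulerCoeff-recursion t j)) ⟩
      binomial (λ t → sgn t * (δ t j + δ t j)) m
        ≡⟨ binomial-cong m (λ t → trans (ℚP.*-distribˡ-+ (sgn t) (δ t j) (δ t j))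
             (trans (cong₂ _+_ (sgn-δ t j) (sgn-δ t j)) (sym (ℚP.*-distribˡ-+ s (δ t j) (δ t j))))) ⟩
      binomial (λ t → s * (δ t j + δ t j)) m
        ≡⟨ binomial-scale m s (λ t → δ t j + δ t j) ⟩
      s * binomial (λ t → δ t j + δ t j) m
        ≡⟨ cong (s *_) (trans (binomial-+ m (λ t → δ t j) (λ t → δ t j)) (cong (λ c → c + c) (binomial-δ m j))) ⟩
      s * (ℕ→ℚ (m C j) + ℕ→ℚ (m C j)) ∎
      where open ≡-Reasoning

    𝕋h : ∀ m → eulerOp h m ≡ δ m j + δ m j
    𝕋h m = begin
      eulerOp h m
        ≡⟨ eulerOp-+ m (λ t → δ t j + δ t j) (λ t → (- s) * alternate g t) ⟩
      eulerOp (λ t → δ t j + δ t j) m + eulerOp (λ t → (- s) * alternate g t) m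
        ≡⟨ cong₂ _+_ (eulerOp-+ m (λ t → δ t j) (λ t → δ t j)) (eulerOp-scale m (- s) (alternate g)) ⟩
      (eulerOp (λ t → δ t j) m + eulerOp (λ t → δ t j) m) + (- s) * eulerOp (alternate g) m
        ≡⟨ cong₂ (λ x y → (x + d) + (x + d) + (- s) * y) (binomial-δ m j) (𝕋-alternate-g m) ⟩
      ((c + d) + (c + d)) + (- s) * (s * (c + c))
        ≡⟨ solve 3 (λ c d s → ((c :+ d) :+ (c :+ d)) :+ (:- s) :* (s :* (c :+ c)) := (d :+ d) :+ (c :+ c) :* (con 1ℚ :- s :* s)) refl c d s ⟩
      (d + d) + (c + c) * (1ℚ - s * s)
        ≡⟨ cong (λ u → (d + d) + (c + c) * (1ℚ - u)) (sgn-square j) ⟩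
      (d + d) + (c + c) * (1ℚ - 1ℚ)
        ≡⟨ solve 2 (λ c d → (d :+ d) :+ (c :+ c) :* (con 1ℚ :- con 1ℚ) := d :+ d) refl c d ⟩
      d + d ∎
      where
      open ≡-Reasoning
      c = ℕ→ℚ (m C j)
      d = δ m j

  eulerCoeff-parity : ∀ j m → j < m → sgn j * sgn m ≡ 1ℚ → eulerCoeff m j ≡ 0ℚ
  eulerCoeff-parity j m j<m sameParity = double-injective e 0ℚ (begin
    e + e                                         ≡⟨ cong (e +_) (eulerCoeff-reflection j m) ⟩
    e + ((δ m j + δ m j) + (- sgn j) * (sgn m * e)) ≡⟨ cong (λ d → e + ((d + d) + (- sgn j) * (sgn m * e))) (>⇒δ≡0 m j j<m) ⟩
    e + ((0ℚ + 0ℚ) + (- sgn j) * (sgn m * e))     ≡⟨ solve 3 (λ e s t → e :+ ((con 0ℚ :+ con 0ℚ) :+ (:- s) :* (t :* e)) := e :- (s :* t) :* e) refl e (sgn j) (sgn m) ⟩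
    e - (sgn j * sgn m) * e                        ≡⟨ cong (λ u → e - u * e) sameParity ⟩
    e - 1ℚ * e                                     ≡⟨ solve 1 (λ e → e :- con 1ℚ :* e := con 0ℚ :+ con 0ℚ) refl e ⟩
    0ℚ + 0ℚ                                        ∎)
    where
    open ≡-Reasoning
    e = eulerCoeff m j

module SelfDualSequences where

  open RationalArithmetic
  open FiniteSums
  open BinomialTransform
  open EulerCoefficients
  open import Data.Nat as ℕ using (ℕ; _≤_; _<_)
  import Data.Nat.Properties as ℕP
  open import Data.Nat.Combinatorics using (_C_)
  open import Data.Rational using (ℚ; 0ℚ; 1ℚ; _+_; _*_; -_)
  import Data.Rational.Properties as ℚP
  open import Data.Rational.Solver using (module +-*-Solver)
  open +-*-Solver
  open import Relation.Binary.PropositionalEquality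

  SelfDual : (ℕ → ℚ) → Set
  SelfDual f = ∀ i → binomial (alternate f) i ≡ f i

  -- Umbral evaluation of the Euler polynomials at f: (ℰ f)ₘ = Σ_{j ≤ m} e_{m,j} fⱼ.
  eulerApply : (ℕ → ℚ) → ℕ → ℚ
  eulerApply f m = sumTo m (λ j → eulerCoeff m j * f j)

  -- 𝔹 commutes with ℰ column by column (the matrix e is lower triangular).
  binomial-eulerApply : ∀ m (f : ℕ → ℚ) →
    binomial (eulerApply f) m ≡ sumTo m (λ j → f j * binomial (λ k → eulerCoeff k j) m)
  binomial-eulerApply m f = begin
    sumTo m (λ k → ℕ→ℚ (m C k) * sumTo k (λ j → eulerCoeff k j * f j))
      ≡⟨ sumTo-cong≤ m (λ k k≤m → cong (ℕ→ℚ (m C k) *_) (sumTo-truncate k m (λ j → eulerCoeff k j * f j) k≤m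
           (λ j k<j _ → trans (cong (_* f j) (above-diagonal k<j)) (ℚP.*-zeroˡ (f j))))) ⟩
    sumTo m (λ k → ℕ→ℚ (m C k) * sumTo m (λ j → eulerCoeff k j * f j))
      ≡⟨ sumTo-cong m (λ k → sym (sumTo-scale m (ℕ→ℚ (m C k)) (λ j → eulerCoeff k j * f j))) ⟩
    sumTo m (λ k → sumTo m (λ j → ℕ→ℚ (m C k) * (eulerCoeff k j * f j)))
      ≡⟨ sumTo-swap m (λ k j → ℕ→ℚ (m C k) * (eulerCoeff k j * f j)) ⟩
    sumTo m (λ j → sumTo m (λ k → ℕ→ℚ (m C k) * (eulerCoeff k j * f j)))
      ≡⟨ sumTo-cong m (λ j → trans
           (sumTo-cong m (λ k → solve 3 (λ c e x → c :* (e :* x) := x :* (c :* e)) refl (ℕ→ℚ (m C k)) (eulerCoeff k j) (f j)))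
           (sumTo-scale m (f j) (λ k → ℕ→ℚ (m C k) * eulerCoeff k j))) ⟩
    sumTo m (λ j → f j * binomial (λ k → eulerCoeff k j) m) ∎
    where
    open ≡-Reasoning
    above-diagonal : ∀ {k j} → k < j → eulerCoeff k j ≡ 0ℚ
    above-diagonal {k} {j} k<j = trans (eulerCoeff-triangular j k (ℕP.<⇒≤ k<j)) (<⇒δ≡0 k j k<j)

  eulerApply-recursion : ∀ m (f : ℕ → ℚ) → eulerOp (eulerApply f) m ≡ f m + f m
  eulerApply-recursion m f = begin
    binomial (eulerApply f) m + eulerApply f m
      ≡⟨ cong (_+ eulerApply f m) (binomial-eulerApply m f) ⟩
    sumTo m (λ j → f j * binomial (e· j) m) + sumTo m (λ j → eulerCoeff m j * f j)
      ≡⟨ sym (sumTo-+ m (λ j → f j * binomial (e· j) m) (λ j → eulerCoeff m j * f j)) ⟩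
    sumTo m (λ j → f j * binomial (e· j) m + eulerCoeff m j * f j)
      ≡⟨ sumTo-cong m (λ j → solve 3 (λ x B e → x :* B :+ e :* x := x :* (B :+ e)) refl (f j) (binomial (e· j) m) (eulerCoeff m j)) ⟩
    sumTo m (λ j → f j * eulerOp (e· j) m)
      ≡⟨ sumTo-cong m (λ j → trans (cong (f j *_) (trans (eulerCoeff-recursion m j) (cong (λ d → d + d) (δ-sym m j))))
                                     (ℚP.*-distribˡ-+ (f j) (δ j m) (δ j m))) ⟩
    sumTo m (λ j → f j * δ j m + f j * δ j m)
      ≡⟨ sumTo-+ m (λ j → f j * δ j m) (λ j → f j * δ j m) ⟩
    sumTo m (λ j → f j * δ j m) + sumTo m (λ j → f j * δ j m)
      ≡⟨ cong (λ x → x + x) (sumTo-δ m m f ℕP.≤-refl) ⟩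
    f m + f m ∎
    where
    open ≡-Reasoning
    e· : ℕ → ℕ → ℚ
    e· j k = eulerCoeff k j

  -- For self-dual f, ℰ f is invariant under the alternating sign: alternate (ℰ f) and
  -- ℰ f have the same image 2f under 𝕋.
  eulerApply-even : ∀ (f : ℕ → ℚ) → SelfDual f → ∀ m → sgn m * eulerApply f m ≡ eulerApply f m
  eulerApply-even f selfDual = eulerOp-injective (alternate (eulerApply f)) (eulerApply f) same
    where
    same : ∀ m → eulerOp (alternate (eulerApply f)) m ≡ eulerOp (eulerApply f) m
    same m = begin
      eulerOp (alternate (eulerApply f)) m
        ≡⟨ eulerOp-alternate m (eulerApply f) ⟩
      binomial (λ t → sgn t * eulerOp (eulerApply f) t) m
        ≡⟨ binomial-cong m (λ t → trans (cong (sgn t *_) (eulerApply-recursion t f)) (ℚP.*-distribˡ-+ (sgn t) (f t) (f t))) ⟩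
      binomial (λ t → alternate f t + alternate f t) m
        ≡⟨ binomial-+ m (alternate f) (alternate f) ⟩
      binomial (alternate f) m + binomial (alternate f) m
        ≡⟨ cong (λ x → x + x) (selfDual m) ⟩
      f m + f m
        ≡⟨ sym (eulerApply-recursion m f) ⟩
      eulerOp (eulerApply f) m ∎
      where open ≡-Reasoning

  eulerApply-odd : ∀ (f : ℕ → ℚ) → SelfDual f → ∀ k → eulerApply f (2 ℕ.* k ℕ.+ 1) ≡ 0ℚ
  eulerApply-odd f selfDual k = double-injective u 0ℚ (begin
    u + u                     ≡⟨ cong (u +_) (sym (eulerApply-even f selfDual (2 ℕ.* k ℕ.+ 1))) ⟩
    u + sgn (2 ℕ.* k ℕ.+ 1) * u ≡⟨ cong (λ s → u + s * u) (sgn-odd k) ⟩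
    u + - 1ℚ * u              ≡⟨ solve 1 (λ u → u :+ (:- con 1ℚ) :* u := con 0ℚ :+ con 0ℚ) refl u ⟩
    0ℚ + 0ℚ                   ∎)
    where
    open ≡-Reasoning
    u = eulerApply f (2 ℕ.* k ℕ.+ 1)

  -- Main identity for self-dual sequences: the odd-indexed value f_{2k+1} is determined
  -- by the even-indexed ones through the Euler coefficients, since in (ℰ f)_{2k+1} = 0 the
  -- odd coefficients e_{2k+1,2j+1} vanish for j < k and e_{2k+1,2k+1} = 1.
  selfDual-odd : ∀ (f : ℕ → ℚ) → SelfDual f → ∀ k →
    f (2 ℕ.* k ℕ.+ 1) ≡ - sumTo k (λ j → eulerCoeff (2 ℕ.* k ℕ.+ 1) (2 ℕ.* j) * f (2 ℕ.* j))
  selfDual-odd f selfDual k = begin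
    f M                   ≡⟨ solve 2 (λ x S → x := :- S :+ (S :+ x)) refl (f M) evens ⟩
    - evens + (evens + f M) ≡⟨ cong (λ y → - evens + (evens + y)) (sym odds≡fM) ⟩
    - evens + (evens + sumTo k oddTerm)
                          ≡⟨ cong (- evens +_) (sym (sumTo-+ k evenTerm oddTerm)) ⟩
    - evens + sumTo k (λ j → evenTerm j + oddTerm j)
                          ≡⟨ cong (- evens +_) (sym (sumTo-pairs k (λ j → eulerCoeff M j * f j))) ⟩
    - evens + eulerApply f M ≡⟨ cong (- evens +_) (eulerApply-odd f selfDual k) ⟩
    - evens + 0ℚ          ≡⟨ ℚP.+-identityʳ (- evens) ⟩
    - evens               ∎
    where
    open ≡-Reasoning
    M = 2 ℕ.* k ℕ.+ 1
    evenTerm oddTerm : ℕ → ℚ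
    evenTerm j = eulerCoeff M (2 ℕ.* j) * f (2 ℕ.* j)
    oddTerm  j = eulerCoeff M (2 ℕ.* j ℕ.+ 1) * f (2 ℕ.* j ℕ.+ 1)
    evens = sumTo k evenTerm

    odds≡fM : sumTo k oddTerm ≡ f M
    odds≡fM = begin
      sumTo k oddTerm ≡⟨ sumTo-last k oddTerm (λ j j<k → trans (cong (_* f (2 ℕ.* j ℕ.+ 1)) (lowerOdd j j<k)) (ℚP.*-zeroˡ (f (2 ℕ.* j ℕ.+ 1)))) ⟩
      eulerCoeff M M * f M ≡⟨ trans (cong (_* f M) (eulerCoeff-diagonal M)) (ℚP.*-identityˡ (f M)) ⟩
      f M ∎
      where
      lowerOdd : ∀ j → j < k → eulerCoeff M (2 ℕ.* j ℕ.+ 1) ≡ 0ℚ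
      lowerOdd j j<k = eulerCoeff-parity (2 ℕ.* j ℕ.+ 1) M (ℕP.+-monoˡ-< 1 (ℕP.*-monoʳ-< 2 j<k))
        (cong₂ _*_ (sgn-odd j) (sgn-odd k))

module PowerSeries {c ℓ} (R : CommutativeRing c ℓ) where

  open import Data.Nat using (ℕ; zero; suc; _∸_)
  open import Data.Product using (_,_)
  import Relation.Binary.Reasoning.Setoid as SetoidReasoning
  import Algebra.Solver.Ring.NaturalCoefficients.Default as NaturalSolver

  open CommutativeRing R
  open SetoidReasoning setoid
  open NaturalSolver commutativeSemiring using (solve; _:+_; _:*_; _:=_)

  Series : Set c
  Series = ℕ → Carrier

  infix 4 _≋_
  _≋_ : Series → Series → Set ℓ
  a ≋ b = ∀ n → a n ≈ b n

  -- (a ⊛ b)ₙ = Σ_{k ≤ n} aₖ b_{n-k}, computed by peeling off a₀.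
  tail : Series → Series
  tail a n = a (suc n)

  infixl 6 _⊕_
  infixl 7 _⊛_

  _⊕_ : Series → Series → Series
  (a ⊕ b) n = a n + b n

  ⊖_ : Series → Series
  (⊖ a) n = - a n

  _⊛_ : Series → Series → Series
  (a ⊛ b) zero    = a 0 * b 0
  (a ⊛ b) (suc n) = a 0 * b (suc n) + (tail a ⊛ b) n

  𝟘 : Series
  𝟘 _ = 0#

  const : Carrier → Series
  const x zero    = x
  const x (suc n) = 0#

  X : Series
  X zero          = 0#
  X (suc zero)    = 1#
  X (suc (suc n)) = 0#

  ⊛-cong : ∀ {a a′ b b′} → a ≋ a′ → b ≋ b′ → a ⊛ b ≋ a′ ⊛ b′
  ⊛-cong a≋a′ b≋b′ zero    = *-cong (a≋a′ 0) (b≋b′ 0)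
  ⊛-cong a≋a′ b≋b′ (suc n) = +-cong (*-cong (a≋a′ 0) (b≋b′ (suc n))) (⊛-cong (λ k → a≋a′ (suc k)) b≋b′ n)

  ⊛-zeroˡ : ∀ b → 𝟘 ⊛ b ≋ 𝟘
  ⊛-zeroˡ b zero    = zeroˡ (b 0)
  ⊛-zeroˡ b (suc n) = trans (+-cong (zeroˡ _) (⊛-zeroˡ b n)) (+-identityˡ _)

  const-⊛ : ∀ x b → const x ⊛ b ≋ (λ n → x * b n)
  const-⊛ x b zero    = refl
  const-⊛ x b (suc n) = trans (+-cong refl (⊛-zeroˡ b n)) (+-identityʳ _)

  ⊛-scaleˡ : ∀ x a b → (λ n → x * a n) ⊛ b ≋ (λ n → x * (a ⊛ b) n)
  ⊛-scaleˡ x a b zero    = *-assoc _ _ _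
  ⊛-scaleˡ x a b (suc n) = begin
    x * a 0 * b (suc n) + ((λ k → x * a (suc k)) ⊛ b) n ≈⟨ +-cong (*-assoc _ _ _) (⊛-scaleˡ x (tail a) b n) ⟩
    x * (a 0 * b (suc n)) + x * (tail a ⊛ b) n          ≈⟨ sym (distribˡ _ _ _) ⟩
    x * (a 0 * b (suc n) + (tail a ⊛ b) n)              ∎

  ⊛-distribʳ : ∀ a b d → (a ⊕ b) ⊛ d ≋ a ⊛ d ⊕ b ⊛ d
  ⊛-distribʳ a b d zero    = distribʳ _ _ _
  ⊛-distribʳ a b d (suc n) = begin
    (a 0 + b 0) * d (suc n) + ((tail a ⊕ tail b) ⊛ d) n
      ≈⟨ +-cong (distribʳ _ _ _) (⊛-distribʳ (tail a) (tail b) d n) ⟩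
    (a 0 * d (suc n) + b 0 * d (suc n)) + ((tail a ⊛ d) n + (tail b ⊛ d) n)
      ≈⟨ solve 4 (λ p q r s → (p :+ q) :+ (r :+ s) := (p :+ r) :+ (q :+ s)) refl _ _ _ _ ⟩
    (a 0 * d (suc n) + (tail a ⊛ d) n) + (b 0 * d (suc n) + (tail b ⊛ d) n) ∎

  -- Commutativity, via moving one factor of the leading coefficients across.
  ⊛-exchange : ∀ n a b → (tail a ⊛ b) n + a 0 * b (suc n) ≈ (a ⊛ tail b) n + b 0 * a (suc n)
  ⊛-exchange zero    a b = trans (+-comm _ _) (+-cong refl (*-comm _ _))
  ⊛-exchange (suc n) a b = begin
    (a 1 * b (suc n) + (tail (tail a) ⊛ b) n) + a 0 * b (suc (suc n))
      ≈⟨ +-cong (+-comm _ _) refl ⟩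
    ((tail (tail a) ⊛ b) n + a 1 * b (suc n)) + a 0 * b (suc (suc n))
      ≈⟨ +-cong (⊛-exchange n (tail a) b) refl ⟩
    ((tail a ⊛ tail b) n + b 0 * a (suc (suc n))) + a 0 * b (suc (suc n))
      ≈⟨ solve 3 (λ x y z → (x :+ y) :+ z := (z :+ x) :+ y) refl _ _ _ ⟩
    (a 0 * b (suc (suc n)) + (tail a ⊛ tail b) n) + b 0 * a (suc (suc n)) ∎

  ⊛-comm : ∀ a b → a ⊛ b ≋ b ⊛ a
  ⊛-comm a b zero    = *-comm _ _
  ⊛-comm a b (suc n) = begin
    a 0 * b (suc n) + (tail a ⊛ b) n ≈⟨ +-comm _ _ ⟩
    (tail a ⊛ b) n + a 0 * b (suc n) ≈⟨ ⊛-exchange n a b ⟩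
    (a ⊛ tail b) n + b 0 * a (suc n) ≈⟨ +-comm _ _ ⟩
    b 0 * a (suc n) + (a ⊛ tail b) n ≈⟨ +-cong refl (⊛-comm a (tail b) n) ⟩
    b 0 * a (suc n) + (tail b ⊛ a) n ∎

  ⊛-assoc : ∀ a b d → (a ⊛ b) ⊛ d ≋ a ⊛ (b ⊛ d)
  ⊛-assoc a b d zero    = *-assoc _ _ _
  ⊛-assoc a b d (suc n) = begin
    a 0 * b 0 * d (suc n) + (((λ k → a 0 * b (suc k)) ⊕ (tail a ⊛ b)) ⊛ d) n
      ≈⟨ +-cong refl (⊛-distribʳ (λ k → a 0 * b (suc k)) (tail a ⊛ b) d n) ⟩
    a 0 * b 0 * d (suc n) + (((λ k → a 0 * b (suc k)) ⊛ d) n + ((tail a ⊛ b) ⊛ d) n)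
      ≈⟨ +-cong refl (+-cong (⊛-scaleˡ (a 0) (tail b) d n) (⊛-assoc (tail a) b d n)) ⟩
    a 0 * b 0 * d (suc n) + (a 0 * (tail b ⊛ d) n + (tail a ⊛ (b ⊛ d)) n)
      ≈⟨ solve 5 (λ x y z u v → x :* y :* z :+ (x :* u :+ v) := x :* (y :* z :+ u) :+ v) refl _ _ _ _ _ ⟩
    a 0 * (b 0 * d (suc n) + (tail b ⊛ d) n) + (tail a ⊛ (b ⊛ d)) n ∎

  ⊛-identityˡ : ∀ a → const 1# ⊛ a ≋ a
  ⊛-identityˡ a n = trans (const-⊛ 1# a n) (*-identityˡ (a n))

  ⊛-distribˡ : ∀ a b d → d ⊛ (a ⊕ b) ≋ d ⊛ a ⊕ d ⊛ b
  ⊛-distribˡ a b d n = trans (⊛-comm d (a ⊕ b) n) (trans (⊛-distribʳ a b d n) (+-cong (⊛-comm a d n) (⊛-comm b d n)))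

  seriesRing : CommutativeRing c ℓ
  seriesRing = record
    { Carrier = Series ; _≈_ = _≋_ ; _+_ = _⊕_ ; _*_ = _⊛_ ; -_ = ⊖_ ; 0# = 𝟘 ; 1# = const 1#
    ; isCommutativeRing = record
      { isRing = record
        { +-isAbelianGroup = record
          { isGroup = record
            { isMonoid = record
              { isSemigroup = record
                { isMagma = record
                  { isEquivalence = record { refl = λ n → refl ; sym = λ p n → sym (p n) ; trans = λ p q n → trans (p n) (q n) }
                  ; ∙-cong = λ p q n → +-cong (p n) (q n) }
                ; assoc = λ a b d n → +-assoc _ _ _ }
              ; identity = (λ a n → +-identityˡ _) , (λ a n → +-identityʳ _) }
            ; inverse = (λ a n → -‿inverseˡ _) , (λ a n → -‿inverseʳ _)
            ; ⁻¹-cong = λ p n → -‿cong (p n) }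
          ; comm = λ a b n → +-comm _ _ }
        ; *-cong = ⊛-cong
        ; *-assoc = ⊛-assoc
        ; *-identity = ⊛-identityˡ , (λ a n → trans (⊛-comm a (const 1#) n) (⊛-identityˡ a n))
        ; distrib = (λ d a b → ⊛-distribˡ a b d) , (λ d a b → ⊛-distribʳ a b d) }
      ; *-comm = ⊛-comm } }

  const-cong : ∀ {x y} → x ≈ y → const x ≋ const y
  const-cong x≈y zero    = x≈y
  const-cong x≈y (suc n) = refl

  const-+ : ∀ x y → const (x + y) ≋ const x ⊕ const y
  const-+ x y zero    = refl
  const-+ x y (suc n) = sym (+-identityˡ _)

  const-* : ∀ x y → const (x * y) ≋ const x ⊛ const y
  const-* x y zero    = refl
  const-* x y (suc n) = sym (trans (const-⊛ x (const y) (suc n)) (zeroʳ x))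

  X-⊛-zero : ∀ a → (X ⊛ a) 0 ≈ 0#
  X-⊛-zero a = zeroˡ _

  X-⊛-suc : ∀ a n → (X ⊛ a) (suc n) ≈ a n
  X-⊛-suc a n = begin
    0# * a (suc n) + (tail X ⊛ a) n ≈⟨ +-cong (zeroˡ _) (⊛-cong tailX≋1 (λ k → refl) n) ⟩
    0# + (const 1# ⊛ a) n           ≈⟨ +-identityˡ _ ⟩
    (const 1# ⊛ a) n                ≈⟨ ⊛-identityˡ a n ⟩
    a n                             ∎
    where
    tailX≋1 : tail X ≋ const 1#
    tailX≋1 zero    = refl
    tailX≋1 (suc k) = refl

  Σ≤ : ℕ → (ℕ → Carrier) → Carrier
  Σ≤ zero    f = f 0
  Σ≤ (suc n) f = Σ≤ n f + f (suc n)

  Σ≤-suc-head : ∀ n f → Σ≤ (suc n) f ≈ f 0 + Σ≤ n (λ k → f (suc k))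
  Σ≤-suc-head zero    f = refl
  Σ≤-suc-head (suc n) f = trans (+-cong (Σ≤-suc-head n f) refl) (+-assoc _ _ _)

  ⊛-as-sum : ∀ a b n → (a ⊛ b) n ≈ Σ≤ n (λ k → a k * b (n ∸ k))
  ⊛-as-sum a b zero    = refl
  ⊛-as-sum a b (suc n) = trans (+-cong refl (⊛-as-sum (tail a) b n)) (sym (Σ≤-suc-head n (λ k → a k * b (suc n ∸ k))))

module BivariateSeries where

  open RationalArithmetic
  open import Data.Nat as ℕ using (ℕ; zero; suc)
  import Data.Nat.Properties as ℕP
  open import Data.Nat.Combinatorics using (_C_; nCn≡1; nCk+nC[k+1]≡[n+1]C[k+1])
  open import Data.Rational using (ℚ; 0ℚ; 1ℚ; _+_; _*_; -_; _-_)
  import Data.Rational.Properties as ℚP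
  open import Data.Rational.Solver using (module +-*-Solver)
  open +-*-Solver
  open import Relation.Binary.PropositionalEquality

  -- Bivariate series F = Σ F n m Zⁿ Wᵐ over ℚ, as series in Z over ℚ[[W]].
  module Inner = PowerSeries ℚP.+-*-commutativeRing
  module Outer = PowerSeries Inner.seriesRing
  open Outer using (_⊛_; _⊕_)

  Bivariate : Set
  Bivariate = ℕ → ℕ → ℚ

  infix 4 _≈₂_
  _≈₂_ : Bivariate → Bivariate → Set
  F ≈₂ G = ∀ n m → F n m ≡ G n m

  scalar : ℚ → Bivariate
  scalar c = Outer.const (Inner.const c)

  Z W : Bivariate
  Z = Outer.X
  W = Outer.const Inner.X

  scalar-⊛ : ∀ c F n m → (scalar c ⊛ F) n m ≡ c * F n m
  scalar-⊛ c F n m = trans (Outer.const-⊛ (Inner.const c) F n m) (Inner.const-⊛ c (F n) m)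

  Z-⊛-zero : ∀ F m → (Z ⊛ F) 0 m ≡ 0ℚ
  Z-⊛-zero F = Outer.X-⊛-zero F

  Z-⊛-suc : ∀ F n m → (Z ⊛ F) (suc n) m ≡ F n m
  Z-⊛-suc = Outer.X-⊛-suc

  W-⊛-zero : ∀ F n → (W ⊛ F) n 0 ≡ 0ℚ
  W-⊛-zero F n = trans (Outer.const-⊛ Inner.X F n 0) (Inner.X-⊛-zero (F n))

  W-⊛-suc : ∀ F n m → (W ⊛ F) n (suc m) ≡ F n m
  W-⊛-suc F n m = trans (Outer.const-⊛ Inner.X F n (suc m)) (Inner.X-⊛-suc (F n) m)

  scaled-relation : ∀ p F G H → (∀ n m → p * F n m + G n m ≡ p * H n m) → (scalar p ⊛ F) ⊕ G ≈₂ scalar p ⊛ H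
  scaled-relation p F G H coeff n m = begin
    (scalar p ⊛ F) n m + G n m ≡⟨ cong (_+ G n m) (scalar-⊛ p F n m) ⟩
    p * F n m + G n m          ≡⟨ coeff n m ⟩
    p * H n m                  ≡⟨ sym (scalar-⊛ p H n m) ⟩
    (scalar p ⊛ H) n m         ∎
    where open ≡-Reasoning

  -- (-1)ᵏ ζ_r({1}ₖ), the coefficients of ∏_{ℓ ≤ r} (1 - x/ℓ).
  alternatingζ : ℕ → ℕ → ℚ
  alternatingζ r k = sgn k * ζ r k

  -- Coefficient form of  (r+1)·a_{r+1} + x·a_r = (r+1)·a_r, i.e. a_{r+1} = (1 - x/(r+1))·a_r.
  alternatingζ-step : ∀ r n → ℕ→ℚ (suc r) * alternatingζ (suc r) (suc n) + alternatingζ r n ≡ ℕ→ℚ (suc r) * alternatingζ r (suc n)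
  alternatingζ-step r n = begin
    p * (- s * (x + inv r * y)) + s * y            ≡⟨ solve 5 (λ p i s x y → p :* ((:- s) :* (x :+ i :* y)) :+ s :* y := p :* ((:- s) :* x) :+ (con 1ℚ :- p :* i) :* (s :* y)) refl p (inv r) s x y ⟩
    p * (- s * x) + (1ℚ - p * inv r) * (s * y)     ≡⟨ cong (λ u → p * (- s * x) + (1ℚ - u) * (s * y)) (ℕ→ℚ-suc-*-inv r) ⟩
    p * (- s * x) + (1ℚ - 1ℚ) * (s * y)            ≡⟨ solve 2 (λ a b → a :+ (con 1ℚ :- con 1ℚ) :* b := a) refl (p * (- s * x)) (s * y) ⟩
    p * (- s * x)                                  ∎
    where
    open ≡-Reasoning
    p = ℕ→ℚ (suc r)
    s = sgn n
    x = ζ r (suc n)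
    y = ζ r n

  -- 𝒜ᵣ(Z) = ∏_{ℓ ≤ r} (1 - Z/ℓ) and 𝒜ᵢ(W), the two factors built from ζᵣ({1}ₖ).
  𝒜Z : ℕ → Bivariate
  𝒜Z r n = Inner.const (alternatingζ r n)

  𝒜W : ℕ → Bivariate
  𝒜W i = Outer.const (alternatingζ i)

  -- ℬ_N(Z,W) = Σ_T ζ⋆_N({1}_T) (Z+W)ᵀ = ∏_{ℓ ≤ N} (1 - (Z+W)/ℓ)⁻¹, with Zⁿ Wᵐ coefficient
  -- C(n+m, m) ζ⋆_N({1}_{n+m}).
  ℬ : ℕ → Bivariate
  ℬ N n m = ℕ→ℚ ((n ℕ.+ m) C m) * ζ⋆ N (n ℕ.+ m)

  𝒜Z-step : ∀ r → (scalar (ℕ→ℚ (suc r)) ⊛ 𝒜Z (suc r)) ⊕ (Z ⊛ 𝒜Z r) ≈₂ scalar (ℕ→ℚ (suc r)) ⊛ 𝒜Z r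
  𝒜Z-step r = scaled-relation p (𝒜Z (suc r)) (Z ⊛ 𝒜Z r) (𝒜Z r) coeff
    where
    p = ℕ→ℚ (suc r)
    coeff : ∀ n m → p * 𝒜Z (suc r) n m + (Z ⊛ 𝒜Z r) n m ≡ p * 𝒜Z r n m
    coeff zero    m       = trans (cong (p * 𝒜Z r 0 m +_) (Z-⊛-zero (𝒜Z r) m)) (ℚP.+-identityʳ _)
    coeff (suc n) zero    = trans (cong (p * alternatingζ (suc r) (suc n) +_) (Z-⊛-suc (𝒜Z r) n 0)) (alternatingζ-step r n)
    coeff (suc n) (suc m) = trans (cong (p * 0ℚ +_) (Z-⊛-suc (𝒜Z r) n (suc m))) (ℚP.+-identityʳ _)

  𝒜W-step : ∀ i → (scalar (ℕ→ℚ (suc i)) ⊛ 𝒜W (suc i)) ⊕ (W ⊛ 𝒜W i) ≈₂ scalar (ℕ→ℚ (suc i)) ⊛ 𝒜W i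
  𝒜W-step i = scaled-relation p (𝒜W (suc i)) (W ⊛ 𝒜W i) (𝒜W i) coeff
    where
    p = ℕ→ℚ (suc i)
    coeff : ∀ n m → p * 𝒜W (suc i) n m + (W ⊛ 𝒜W i) n m ≡ p * 𝒜W i n m
    coeff zero    zero    = trans (cong (p * 1ℚ +_) (W-⊛-zero (𝒜W i) 0)) (ℚP.+-identityʳ _)
    coeff zero    (suc m) = trans (cong (p * alternatingζ (suc i) (suc m) +_) (W-⊛-suc (𝒜W i) 0 m)) (alternatingζ-step i m)
    coeff (suc n) zero    = trans (cong (p * 0ℚ +_) (W-⊛-zero (𝒜W i) (suc n))) (ℚP.+-identityʳ _)
    coeff (suc n) (suc m) = trans (cong (p * 0ℚ +_) (W-⊛-suc (𝒜W i) (suc n) m)) (ℚP.+-identityʳ _)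

  ζ⋆-step : ∀ N T c → ℕ→ℚ (suc N) * (c * ζ⋆ N (suc T)) + c * ζ⋆ (suc N) T ≡ ℕ→ℚ (suc N) * (c * ζ⋆ (suc N) (suc T))
  ζ⋆-step N T c = begin
    p * (c * x) + c * y               ≡⟨ cong (p * (c * x) +_) (sym (ℚP.*-identityˡ (c * y))) ⟩
    p * (c * x) + 1ℚ * (c * y)        ≡⟨ cong (λ u → p * (c * x) + u * (c * y)) (sym (ℕ→ℚ-suc-*-inv N)) ⟩
    p * (c * x) + (p * inv N) * (c * y) ≡⟨ solve 5 (λ p i c x y → p :* (c :* x) :+ (p :* i) :* (c :* y) := p :* (c :* (x :+ i :* y))) refl p (inv N) c x y ⟩
    p * (c * (x + inv N * y))         ∎
    where
    open ≡-Reasoning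
    p = ℕ→ℚ (suc N)
    x = ζ⋆ N (suc T)
    y = ζ⋆ (suc N) T

  -- Coefficientwise form of the step relation for ℬ below: at (n+1, m+1) it is the ζ⋆
  -- recursion combined with Pascal's rule C(T+1,m+1) + C(T+1,m) = C(T+2,m+1); the
  -- boundary coefficients only involve C(T,T) = 1.
  module _ (N : ℕ) where
    open ≡-Reasoning
    private
      p : ℚ
      p = ℕ→ℚ (suc N)
      ℬ₊ : Bivariate
      ℬ₊ = ℬ (suc N)

    ℬ-step-coefficient : ∀ n m → p * ℬ N n m + ((Z ⊛ ℬ₊) n m + (W ⊛ ℬ₊) n m) ≡ p * ℬ₊ n m
    ℬ-step-coefficient zero zero = begin
      p * ℬ N 0 0 + ((Z ⊛ ℬ₊) 0 0 + (W ⊛ ℬ₊) 0 0) ≡⟨ cong₂ (λ x y → p * ℬ N 0 0 + (x + y)) (Z-⊛-zero ℬ₊ 0) (W-⊛-zero ℬ₊ 0) ⟩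
      p * ℬ N 0 0 + (0ℚ + 0ℚ)                     ≡⟨ ℚP.+-identityʳ _ ⟩
      p * ℬ₊ 0 0                                  ∎
    ℬ-step-coefficient (suc n) zero = begin
      p * ℬ N (suc n) 0 + ((Z ⊛ ℬ₊) (suc n) 0 + (W ⊛ ℬ₊) (suc n) 0)
        ≡⟨ cong₂ (λ x y → p * ℬ N (suc n) 0 + (x + y)) (Z-⊛-suc ℬ₊ n 0) (W-⊛-zero ℬ₊ (suc n)) ⟩
      p * ℬ N (suc n) 0 + (ℬ₊ n 0 + 0ℚ)
        ≡⟨ cong (p * ℬ N (suc n) 0 +_) (ℚP.+-identityʳ _) ⟩
      p * (1ℚ * ζ⋆ N (suc (n ℕ.+ 0))) + 1ℚ * ζ⋆ (suc N) (n ℕ.+ 0)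
        ≡⟨ ζ⋆-step N (n ℕ.+ 0) 1ℚ ⟩
      p * ℬ₊ (suc n) 0 ∎
    ℬ-step-coefficient zero (suc m) = begin
      p * ℬ N 0 (suc m) + ((Z ⊛ ℬ₊) 0 (suc m) + (W ⊛ ℬ₊) 0 (suc m))
        ≡⟨ cong₂ (λ x y → p * ℬ N 0 (suc m) + (x + y)) (Z-⊛-zero ℬ₊ (suc m)) (W-⊛-suc ℬ₊ 0 m) ⟩
      p * ℬ N 0 (suc m) + (0ℚ + ℬ₊ 0 m)
        ≡⟨ cong (p * ℬ N 0 (suc m) +_) (ℚP.+-identityˡ _) ⟩
      p * (ℕ→ℚ (suc m C suc m) * ζ⋆ N (suc m)) + ℕ→ℚ (m C m) * ζ⋆ (suc N) m
        ≡⟨ cong₂ (λ a b → p * (ℕ→ℚ a * ζ⋆ N (suc m)) + ℕ→ℚ b * ζ⋆ (suc N) m) (nCn≡1 (suc m)) (nCn≡1 m) ⟩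
      p * (1ℚ * ζ⋆ N (suc m)) + 1ℚ * ζ⋆ (suc N) m
        ≡⟨ ζ⋆-step N m 1ℚ ⟩
      p * (1ℚ * ζ⋆ (suc N) (suc m))
        ≡⟨ cong (λ a → p * (ℕ→ℚ a * ζ⋆ (suc N) (suc m))) (sym (nCn≡1 (suc m))) ⟩
      p * ℬ₊ 0 (suc m) ∎
    ℬ-step-coefficient (suc n) (suc m) = begin
      p * ℬ N (suc n) (suc m) + ((Z ⊛ ℬ₊) (suc n) (suc m) + (W ⊛ ℬ₊) (suc n) (suc m))
        ≡⟨ cong₂ (λ x y → p * ℬ N (suc n) (suc m) + (x + y)) (Z-⊛-suc ℬ₊ n (suc m)) (W-⊛-suc ℬ₊ (suc n) m) ⟩
      p * ℬ N (suc n) (suc m) + (ℬ₊ n (suc m) + ℬ₊ (suc n) m)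
        ≡⟨ cong (λ t → p * (ℕ→ℚ (suc t C suc m) * ζ⋆ N (suc t)) + (ℕ→ℚ (t C suc m) * ζ⋆ (suc N) t + ℬ₊ (suc n) m)) (ℕP.+-suc n m) ⟩
      p * (ℕ→ℚ (suc (suc T) C suc m) * ζ⋆ N (suc (suc T))) + (ℕ→ℚ (suc T C suc m) * ζ⋆ (suc N) (suc T) + ℕ→ℚ (suc T C m) * ζ⋆ (suc N) (suc T))
        ≡⟨ cong (p * (ℕ→ℚ (suc (suc T) C suc m) * ζ⋆ N (suc (suc T))) +_) pascal ⟩
      p * (ℕ→ℚ (suc (suc T) C suc m) * ζ⋆ N (suc (suc T))) + ℕ→ℚ (suc (suc T) C suc m) * ζ⋆ (suc N) (suc T)
        ≡⟨ ζ⋆-step N (suc T) (ℕ→ℚ (suc (suc T) C suc m)) ⟩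
      p * (ℕ→ℚ (suc (suc T) C suc m) * ζ⋆ (suc N) (suc (suc T)))
        ≡⟨ cong (λ t → p * (ℕ→ℚ (suc t C suc m) * ζ⋆ (suc N) (suc t))) (sym (ℕP.+-suc n m)) ⟩
      p * ℬ₊ (suc n) (suc m) ∎
      where
      T = n ℕ.+ m
      pascal : ℕ→ℚ (suc T C suc m) * ζ⋆ (suc N) (suc T) + ℕ→ℚ (suc T C m) * ζ⋆ (suc N) (suc T)
             ≡ ℕ→ℚ (suc (suc T) C suc m) * ζ⋆ (suc N) (suc T)
      pascal = begin
        ℕ→ℚ (suc T C suc m) * z + ℕ→ℚ (suc T C m) * z ≡⟨ sym (ℚP.*-distribʳ-+ z (ℕ→ℚ (suc T C suc m)) (ℕ→ℚ (suc T C m))) ⟩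
        (ℕ→ℚ (suc T C suc m) + ℕ→ℚ (suc T C m)) * z  ≡⟨ cong (_* z) (trans (ℚP.+-comm (ℕ→ℚ (suc T C suc m)) (ℕ→ℚ (suc T C m))) (sym (ℕ→ℚ-+ (suc T C m) (suc T C suc m)))) ⟩
        ℕ→ℚ (suc T C m ℕ.+ suc T C suc m) * z        ≡⟨ cong (λ a → ℕ→ℚ a * z) (nCk+nC[k+1]≡[n+1]C[k+1] (suc T) m) ⟩
        ℕ→ℚ (suc (suc T) C suc m) * z                ∎
        where z = ζ⋆ (suc N) (suc T)

  -- (N+1)·ℬ_N + (Z+W)·ℬ_{N+1} = (N+1)·ℬ_{N+1}, i.e. ℬ_{N+1} = ℬ_N / (1 - (Z+W)/(N+1)).
  ℬ-step : ∀ N → (scalar (ℕ→ℚ (suc N)) ⊛ ℬ N) ⊕ ((Z ⊕ W) ⊛ ℬ (suc N)) ≈₂ scalar (ℕ→ℚ (suc N)) ⊛ ℬ (suc N)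
  ℬ-step N = scaled-relation (ℕ→ℚ (suc N)) (ℬ N) ((Z ⊕ W) ⊛ ℬ (suc N)) (ℬ (suc N)) (λ n m →
    trans (cong (ℕ→ℚ (suc N) * ℬ N n m +_) (Outer.⊛-distribʳ Z W (ℬ (suc N)) n m)) (ℬ-step-coefficient N n m))

module Weights where

  open RationalArithmetic using (ℕ→ℚ-suc-*-inv)
  open import Data.Nat as ℕ using (ℕ; zero; suc)
  import Data.Nat.Properties as ℕP
  open import Data.Rational using (ℚ; 1ℚ; _*_)
  import Data.Rational.Properties as ℚP
  open import Data.Rational.Solver using (module +-*-Solver)
  open +-*-Solver
  open import Relation.Binary.PropositionalEquality

  factorial : ℕ → ℚ
  factorial zero    = 1ℚ
  factorial (suc n) = factorial n * ℕ→ℚ (suc n)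

  invFactorial : ℕ → ℚ
  invFactorial zero    = 1ℚ
  invFactorial (suc n) = invFactorial n * inv n

  weight : ℕ → ℕ → ℚ
  weight i r = factorial r * factorial i * invFactorial (suc (r ℕ.+ i))

  weight-sucʳ : ∀ i r → weight i (suc r) ≡ weight i r * ℕ→ℚ (suc r) * inv (suc (r ℕ.+ i))
  weight-sucʳ i r = solve 5 (λ a p b f v → (a :* p) :* b :* (f :* v) := a :* b :* f :* p :* v) refl
    (factorial r) (ℕ→ℚ (suc r)) (factorial i) (invFactorial (suc (r ℕ.+ i))) (inv (suc (r ℕ.+ i)))

  weight-sucˡ : ∀ i r → weight (suc i) r ≡ weight i r * ℕ→ℚ (suc i) * inv (suc (r ℕ.+ i))
  weight-sucˡ i r = trans (cong (λ k → factorial r * (factorial i * ℕ→ℚ (suc i)) * invFactorial (suc k)) (ℕP.+-suc r i))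
    (solve 5 (λ a b q f v → a :* (b :* q) :* (f :* v) := a :* b :* f :* q :* v) refl
      (factorial r) (factorial i) (ℕ→ℚ (suc i)) (invFactorial (suc (r ℕ.+ i))) (inv (suc (r ℕ.+ i))))

  factorial-*-invFactorial : ∀ r → factorial r * invFactorial r ≡ 1ℚ
  factorial-*-invFactorial zero    = refl
  factorial-*-invFactorial (suc r) = begin
    (factorial r * ℕ→ℚ (suc r)) * (invFactorial r * inv r)
      ≡⟨ solve 4 (λ a p b v → (a :* p) :* (b :* v) := (a :* b) :* (p :* v)) refl (factorial r) (ℕ→ℚ (suc r)) (invFactorial r) (inv r) ⟩
    (factorial r * invFactorial r) * (ℕ→ℚ (suc r) * inv r)
      ≡⟨ cong₂ _*_ (factorial-*-invFactorial r) (ℕ→ℚ-suc-*-inv r) ⟩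
    1ℚ ∎
    where open ≡-Reasoning

  weight-top : ∀ r → weight 0 r ≡ inv r
  weight-top r = begin
    factorial r * 1ℚ * invFactorial (suc (r ℕ.+ 0)) ≡⟨ cong (λ k → factorial r * 1ℚ * invFactorial (suc k)) (ℕP.+-identityʳ r) ⟩
    factorial r * 1ℚ * (invFactorial r * inv r)     ≡⟨ solve 3 (λ a f v → a :* con 1ℚ :* (f :* v) := (a :* f) :* v) refl (factorial r) (invFactorial r) (inv r) ⟩
    (factorial r * invFactorial r) * inv r           ≡⟨ trans (cong (_* inv r) (factorial-*-invFactorial r)) (ℚP.*-identityˡ (inv r)) ⟩
    inv r                                            ∎
    where open ≡-Reasoning

  weight-left : ∀ i → weight i 0 ≡ inv i
  weight-left i = begin
    1ℚ * factorial i * (invFactorial i * inv i) ≡⟨ solve 3 (λ a f v → con 1ℚ :* a :* (f :* v) := (a :* f) :* v) refl (factorial i) (invFactorial i) (inv i) ⟩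
    (factorial i * invFactorial i) * inv i       ≡⟨ trans (cong (_* inv i) (factorial-*-invFactorial i)) (ℚP.*-identityˡ (inv i)) ⟩
    inv i                                        ∎
    where open ≡-Reasoning

module DifferenceTable where

  open RationalArithmetic using (ℕ→ℚ-+; ℕ→ℚ-suc-*-inv)
  open BivariateSeries
  open Weights
  open import Data.Nat as ℕ using (ℕ; zero; suc)
  import Data.Nat.Properties as ℕP
  open import Data.Rational using (1ℚ) renaming (_+_ to _+ℚ_; _*_ to _*ℚ_)
  open import Relation.Binary.PropositionalEquality as ≡ using (_≡_)
  import Relation.Binary.Reasoning.Setoid as SetoidReasoning
  import Algebra.Solver.Ring.NaturalCoefficients.Default as NaturalSolver
  import Algebra.Properties.Group as GroupProperties

  open CommutativeRing Outer.seriesRing using (_≈_; _+_; _*_; 1#; +-cong; *-cong; refl; sym; trans; setoid; +-group; commutativeSemiring)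
  open NaturalSolver commutativeSemiring using (solve; _:+_; _:*_; _:=_; con)
  open GroupProperties +-group using () renaming (∙-cancelʳ to +-cancelʳ)

  scalar-cong : ∀ {a b} → a ≡ b → scalar a ≈ scalar b
  scalar-cong ≡.refl = refl

  scalar-+ : ∀ a b → scalar (a +ℚ b) ≈ scalar a + scalar b
  scalar-+ a b = trans (Outer.const-cong (Inner.const-+ a b)) (Outer.const-+ (Inner.const a) (Inner.const b))

  scalar-* : ∀ a b → scalar (a *ℚ b) ≈ scalar a * scalar b
  scalar-* a b = trans (Outer.const-cong (Inner.const-* a b)) (Outer.const-* (Inner.const a) (Inner.const b))

  scalar-1 : scalar 1ℚ ≈ 1#
  scalar-1 zero    zero    = ≡.refl
  scalar-1 zero    (suc m) = ≡.refl
  scalar-1 (suc n) m       = ≡.refl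

  𝒬 : ℕ → ℕ → Bivariate
  𝒬 i r = scalar (weight i r) * ((𝒜Z r * 𝒜W i) * ℬ (suc (r ℕ.+ i)))

  -- With N = r+i+1, c = weight i r and
  -- u = 1/(N+1), the right side is c·u·((r+1)𝒜ᵣ₊₁(Z)𝒜ᵢ(W) + (i+1)𝒜ᵣ(Z)𝒜ᵢ₊₁(W))·ℬ_{N+1}.
  -- As (r+1)𝒜ᵣ₊₁ = (r+1-Z)𝒜ᵣ and (i+1)𝒜ᵢ₊₁ = (i+1-W)𝒜ᵢ, this is
  -- c·u·𝒜ᵣ𝒜ᵢ·(N+1-Z-W)·ℬ_{N+1} = c·𝒜ᵣ𝒜ᵢ·ℬ_N, the left side.  The subtraction of Z + W
  -- is avoided by adding E = c·u·𝒜ᵣ𝒜ᵢℬ_{N+1}·(Z+W) to both sides and cancelling; the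
  -- rearrangements are done by the semiring solver.
  𝒬-pascal : ∀ i r → 𝒬 i r ≈ 𝒬 i (suc r) + 𝒬 (suc i) r
  𝒬-pascal i r = sym (+-cancelʳ E (𝒬 i (suc r) + 𝒬 (suc i) r) (𝒬 i r) (begin
    𝒬 i (suc r) + 𝒬 (suc i) r + E
      ≈⟨ +-cong (+-cong (*-cong (trans (scalar-cong (weight-sucʳ i r)) (scalar-*³ _ _ _)) refl)
                        (*-cong (trans (scalar-cong (weight-sucˡ i r)) (scalar-*³ _ _ _))
                                (*-cong refl (≡.subst (λ k → ℬ (suc (r ℕ.+ suc i)) ≈ ℬ k) (≡.cong suc (ℕP.+-suc r i)) refl)))) refl ⟩
      (c * p * u) * ((α₊ * α′) * β) + (c * q * u) * ((α * α′₊) * β) + E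
      ≈⟨ solve 11 (λ c u p q α α₊ α′ α′₊ β z w →
           (c :* p :* u) :* ((α₊ :* α′) :* β) :+ (c :* q :* u) :* ((α :* α′₊) :* β) :+ c :* u :* α :* α′ :* β :* (z :+ w)
           := c :* u :* α′ :* β :* (p :* α₊ :+ z :* α) :+ c :* u :* α :* β :* (q :* α′₊ :+ w :* α′)) refl c u p q α α₊ α′ α′₊ β Z W ⟩
    c * u * α′ * β * (p * α₊ + Z * α) + c * u * α * β * (q * α′₊ + W * α′)
      ≈⟨ +-cong (*-cong refl (𝒜Z-step r)) (*-cong refl (𝒜W-step i)) ⟩
    c * u * α′ * β * (p * α) + c * u * α * β * (q * α′)
      ≈⟨ solve 7 (λ c u p q α α′ β → c :* u :* α′ :* β :* (p :* α) :+ c :* u :* α :* β :* (q :* α′)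
                                     := c :* u :* α :* α′ :* ((p :+ q) :* β)) refl c u p q α α′ β ⟩
    c * u * α * α′ * ((p + q) * β)
      ≈⟨ *-cong refl (*-cong (sym (trans (scalar-cong N+1≡) (scalar-+ (ℕ→ℚ (suc r)) (ℕ→ℚ (suc i))))) refl) ⟩
    c * u * α * α′ * (n₊ * β)
      ≈⟨ *-cong refl (sym (ℬ-step N)) ⟩
    c * u * α * α′ * (n₊ * β₀ + (Z + W) * β)
      ≈⟨ solve 9 (λ c u n₊ α α′ β₀ β z w → c :* u :* α :* α′ :* (n₊ :* β₀ :+ (z :+ w) :* β)
                                          := c :* ((α :* α′) :* β₀) :* (n₊ :* u) :+ c :* u :* α :* α′ :* β :* (z :+ w)) refl c u n₊ α α′ β₀ β Z W ⟩
    c * ((α * α′) * β₀) * (n₊ * u) + E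
      ≈⟨ +-cong (*-cong refl (trans (sym (scalar-* (ℕ→ℚ (suc N)) (inv N))) (trans (scalar-cong (ℕ→ℚ-suc-*-inv N)) scalar-1))) refl ⟩
    c * ((α * α′) * β₀) * 1# + E
      ≈⟨ solve 2 (λ x e → x :* con 1 :+ e := x :+ e) refl (c * ((α * α′) * β₀)) E ⟩
    𝒬 i r + E ∎))
    where
    open SetoidReasoning setoid
    N  = suc (r ℕ.+ i)
    c  = scalar (weight i r)
    u  = scalar (inv N)
    p  = scalar (ℕ→ℚ (suc r))
    q  = scalar (ℕ→ℚ (suc i))
    n₊ = scalar (ℕ→ℚ (suc N))
    α  = 𝒜Z r
    α₊ = 𝒜Z (suc r)
    α′ = 𝒜W i
    α′₊ = 𝒜W (suc i)
    β₀ = ℬ N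
    β  = ℬ (suc N)
    E  = c * u * α * α′ * β * (Z + W)

    scalar-*³ : ∀ a b d → scalar (a *ℚ b *ℚ d) ≈ scalar a * scalar b * scalar d
    scalar-*³ a b d = trans (scalar-* (a *ℚ b) d) (*-cong (scalar-* a b) refl)

    N+1≡ : ℕ→ℚ (suc N) ≡ ℕ→ℚ (suc r) +ℚ ℕ→ℚ (suc i)
    N+1≡ = ≡.trans (≡.cong ℕ→ℚ (≡.cong suc (≡.sym (ℕP.+-suc r i)))) (ℕ→ℚ-+ (suc r) (suc i))

module TierDuality where

  open FiniteSums using (sumTo-cong)
  open BinomialTransform using (binomial; binomial-cong; alternate; difference-table)
  open BivariateSeries
  open Weights
  open DifferenceTable
  open import Data.Nat as ℕ using (ℕ; zero; suc; _∸_)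
  import Data.Nat.Properties as ℕP
  open import Data.Nat.Combinatorics using (_C_; nCk≡nC[n∸k])
  open import Data.Rational using (ℚ; _+_; _*_; _-_)
  import Data.Rational.Properties as ℚP
  open import Data.Rational.Solver using (module +-*-Solver)
  open +-*-Solver
  open import Relation.Binary.PropositionalEquality

  module 𝕊 = CommutativeRing Outer.seriesRing

  𝒜Z-zero : 𝒜Z 0 𝕊.≈ 𝕊.1#
  𝒜Z-zero zero    zero    = refl
  𝒜Z-zero zero    (suc m) = refl
  𝒜Z-zero (suc n) zero    = ℚP.*-zeroʳ (sgn (suc n))
  𝒜Z-zero (suc n) (suc m) = refl

  𝒜W-zero : 𝒜W 0 𝕊.≈ 𝕊.1#
  𝒜W-zero zero    zero    = refl
  𝒜W-zero zero    (suc m) = ℚP.*-zeroʳ (sgn (suc m))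
  𝒜W-zero (suc n) m       = refl

  Σ≤-at : ∀ n (F : ℕ → Inner.Series) m → Outer.Σ≤ n F m ≡ sumTo n (λ k → F k m)
  Σ≤-at zero    F m = refl
  Σ≤-at (suc n) F m = cong (_+ F (suc n) m) (Σ≤-at n F m)

  Σ≤-inner : ∀ n (F : ℕ → ℚ) → Inner.Σ≤ n F ≡ sumTo n F
  Σ≤-inner zero    F = refl
  Σ≤-inner (suc n) F = cong (_+ F (suc n)) (Σ≤-inner n F)

  𝒬-top : ∀ r n m → 𝒬 0 r n m ≡ tier r n m
  𝒬-top r n m = begin
    𝒬 0 r n m
      ≡⟨ scalar-⊛ (weight 0 r) ((𝒜Z r 𝕊.* 𝒜W 0) 𝕊.* ℬ (suc (r ℕ.+ 0))) n m ⟩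
    weight 0 r * ((𝒜Z r 𝕊.* 𝒜W 0) 𝕊.* ℬ (suc (r ℕ.+ 0))) n m
      ≡⟨ cong₂ _*_ (weight-top r) (𝕊.*-cong {𝒜Z r 𝕊.* 𝒜W 0} {𝒜Z r} {ℬ (suc (r ℕ.+ 0))} {ℬ (suc r)}
            (𝕊.trans (𝕊.*-cong {𝒜Z r} {𝒜Z r} 𝕊.refl 𝒜W-zero) (𝕊.*-identityʳ (𝒜Z r)))
            (subst (λ k → ℬ (suc (r ℕ.+ 0)) 𝕊.≈ ℬ (suc k)) (ℕP.+-identityʳ r) 𝕊.refl) n m) ⟩
    inv r * (𝒜Z r 𝕊.* ℬ (suc r)) n m
      ≡⟨ cong (inv r *_) (trans (Outer.⊛-as-sum (𝒜Z r) (ℬ (suc r)) n m) (Σ≤-at n (λ k → 𝒜Z r k Inner.⊛ ℬ (suc r) (n ∸ k)) m)) ⟩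
    inv r * sumTo n (λ k → (𝒜Z r k Inner.⊛ ℬ (suc r) (n ∸ k)) m)
      ≡⟨ cong (inv r *_) (sumTo-cong n (λ k → trans (Inner.const-⊛ (alternatingζ r k) (ℬ (suc r) (n ∸ k)) m)
            (solve 4 (λ s z c w → (s :* z) :* (c :* w) := s :* c :* z :* w) refl
              (sgn k) (ζ r k) (ℕ→ℚ ((n ∸ k ℕ.+ m) C m)) (ζ⋆ (suc r) (n ∸ k ℕ.+ m))))) ⟩
    tier r n m ∎
    where open ≡-Reasoning

  𝒬-left : ∀ i n m → 𝒬 i 0 n m ≡ tier i m n
  𝒬-left i n m = begin
    𝒬 i 0 n m
      ≡⟨ scalar-⊛ (weight i 0) ((𝒜Z 0 𝕊.* 𝒜W i) 𝕊.* ℬ (suc i)) n m ⟩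
    weight i 0 * ((𝒜Z 0 𝕊.* 𝒜W i) 𝕊.* ℬ (suc i)) n m
      ≡⟨ cong₂ _*_ (weight-left i) (𝕊.*-cong {𝒜Z 0 𝕊.* 𝒜W i} {𝒜W i} {ℬ (suc i)} {ℬ (suc i)}
            (𝕊.trans (𝕊.*-cong {𝒜Z 0} {𝕊.1#} {𝒜W i} {𝒜W i} 𝒜Z-zero 𝕊.refl) (𝕊.*-identityˡ (𝒜W i))) 𝕊.refl n m) ⟩
    inv i * (𝒜W i 𝕊.* ℬ (suc i)) n m
      ≡⟨ cong (inv i *_) (trans (Outer.const-⊛ (alternatingζ i) (ℬ (suc i)) n m)
           (trans (Inner.⊛-as-sum (alternatingζ i) (ℬ (suc i) n) m) (Σ≤-inner m _))) ⟩
    inv i * sumTo m (λ k → alternatingζ i k * ℬ (suc i) n (m ∸ k))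
      ≡⟨ cong (inv i *_) (sumTo-cong m (λ k → trans
           (cong₂ (λ c t → alternatingζ i k * (ℕ→ℚ c * ζ⋆ (suc i) t)) (binomial-symmetric (m ∸ k) n) (ℕP.+-comm n (m ∸ k)))
           (solve 4 (λ s z c w → (s :* z) :* (c :* w) := s :* c :* z :* w) refl
             (sgn k) (ζ i k) (ℕ→ℚ ((m ∸ k ℕ.+ n) C n)) (ζ⋆ (suc i) (m ∸ k ℕ.+ n))))) ⟩
    tier i m n ∎
    where
    open ≡-Reasoning
    binomial-symmetric : ∀ j n → (n ℕ.+ j) C j ≡ (j ℕ.+ n) C n
    binomial-symmetric j n = sym (begin
      (j ℕ.+ n) C n               ≡⟨ nCk≡nC[n∸k] (ℕP.m≤n+m n j) ⟩
      (j ℕ.+ n) C (j ℕ.+ n ∸ n)   ≡⟨ cong ((j ℕ.+ n) C_) (ℕP.m+n∸n≡m j n) ⟩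
      (j ℕ.+ n) C j               ≡⟨ cong (_C j) (ℕP.+-comm j n) ⟩
      (n ℕ.+ j) C j               ∎)

  -- The table i, r ↦ [Zⁿ Wᵐ] 𝒬ᵢᵣ is a difference table (Pascal's rule) whose top row is
  -- ((n,m)_r)_r and whose left column is ((m,n)_i)_i.
  tier-duality : ∀ n m i → binomial (alternate (λ j → tier j n m)) i ≡ tier i m n
  tier-duality n m i = begin
    binomial (λ j → sgn j * tier j n m) i          ≡⟨ binomial-cong i (λ j → cong (λ t → sgn j * tier t n m) (sym (ℕP.+-identityʳ j))) ⟩
    binomial (λ j → sgn j * tier (j ℕ.+ 0) n m) i  ≡⟨ difference-table (λ i r → 𝒬 i r n m) (λ j → tier j n m) (λ r → 𝒬-top r n m) step i 0 ⟩
    𝒬 i 0 n m                                      ≡⟨ 𝒬-left i n m ⟩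
    tier i m n                                     ∎
    where
    open ≡-Reasoning
    step : ∀ i r → 𝒬 (suc i) r n m ≡ 𝒬 i r n m - 𝒬 i (suc r) n m
    step i r = begin
      𝒬 (suc i) r n m                                    ≡⟨ solve 2 (λ a b → b := (a :+ b) :- a) refl (𝒬 i (suc r) n m) (𝒬 (suc i) r n m) ⟩
      (𝒬 i (suc r) n m + 𝒬 (suc i) r n m) - 𝒬 i (suc r) n m ≡⟨ cong (_- 𝒬 i (suc r) n m) (sym (𝒬-pascal i r n m)) ⟩
      𝒬 i r n m - 𝒬 i (suc r) n m                        ∎

open SelfDualSequences using (selfDual-odd)
open TierDuality using (tier-duality)
open import Data.Nat using (ℕ; _+_; _*_)
open import Data.Rational using (ℚ; -_) renaming (_*_ to _*ℚ_)
open import Relation.Binary.PropositionalEquality using (_≡_)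

proposition3p11 : ∀ (k n : ℕ) →
    tier (2 * k + 1) n n ≡ - sumTo k (λ j → eulerCoeff (2 * k + 1) (2 * j) *ℚ tier (2 * j) n n)
proposition3p11 k n = selfDual-odd (λ j → tier j n n) (tier-duality n n) k
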